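{- Let $T=[t_{i,j}]$ be a framed tableau and $x\ge0$ an integer with $x+1\le t_{1,1}$. Then $T\leftarrow(x+1)=\big((T-x)\leftarrow1\big)+x$, and, when $x+1=t_{1,1}$, ${}_{x+1}T=\big({}_1(T-x)\big)+x$. Here $T\pm c$ denotes the tableau obtained by adding/subtracting $c$ to/from every entry.
   Context: Tableaux: for a partition $\mu=(\mu_1\ge\dots\ge\mu_r)$, $D_\mu=\{(i,j):1\le i\le r,1\le j\le\mu_i\}$ (row $i$ from the bottom); a tableau is $T:D_\mu\to\mathbb{Z}_{>0}$, $t_{i,j}=T(i,j)$, $t_{i,j}=\infty$ off $D_\mu$. $\mathrm{Bcomp}(c,m)$: the unique weakly increasing integer sequence of length $m$ with sum $c$ and max minus min at most $1$. Framing condition on $(\mu,s)$: $s_i\ge(2i-1)\mu_i$ for all $i$ and $s_{i+1}\ge s_i+2\mu_i$ whenever $\mu_{i+1}=\mu_i$. $\mathrm{Fram}(\mu,s)$ (with $\mu_{r+1}=0$): row $r$ is $\mathrm{Bcomp}(s_r,\mu_r)$; for $i=r-1$ down to $1$: $a=s_i$, $b=\mu_i$; for $k=r,\dots,i$: $(r_{i,\mu_{k+1}+1},\dots,r_{i,\mu_i})=\mathrm{Bcomp}(a,b)$; if $r_{i,j}\le t_{i+1,j}-2$ for all $\mu_{k+1}<j\le\mu_k$ set $t_{i,j}=r_{i,j}$ for these $j$, else $t_{i,j}=t_{i+1,j}-2$; then $a:=a-\sum_{\mu_{k+1}<j\le\mu_k}t_{i,j}$, $b:=b-(\mu_k-\mu_{k+1})$.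 Framed tableaux: the tableaux $\mathrm{Fram}(\mu,s)$ with $(\mu,s)$ satisfying the framing condition. Insertion $T\leftarrow x$ ($0<x\le t_{1,1}$): Step 1: $i=1$, $x_0=x$; while row $i$ is nonempty and $t_{i,\mu_i}\ge x+2$: let $j$ be least with $t_{i,j}\ge x+2$, $y=t_{i,j}$, replace $t_{i,j}$ by $x$, sort row $i$, $x=y$, $i=i+1$; then append $x$ to row $i$ and sort; call the result $Y=[y_{i,j}]$ with shape $\mu'=(\mu'_1,\dots,\mu'_{l'})$ and row sums $(s_1,\dots,s_{l'})$. Step 2: $x=x_0$, $d_2=\dots=d_{l'}=0$; for $k=1,\dots,l'-1$, stopping at the first $k$ for which $y_{k,\mu'_k}\ge x+2$ fails: for $j=1,\dots,\mu'_{k+1}$, if $y_{k,j}=x$ set $y_{k+1,j}=x+2$, and if $y_{k,\mu'_k}>x+2$ and $y_{k,j}=x+1$ set $y_{k+1,j}=x+3$ (in $Y$); then $d_{k+1}=s_{k+1}-\sum_{j\le\mu'_{k+1}}y_{k+1,j}$, $x=x+2$. Let $s'=(s_1+d_2,s_2+d_3-d_2,\dots,s_{l'}-d_{l'})$. Step 3: $T\leftarrow x=\mathrm{Fram}(\mu',s')$. Removal ${}_xT$ ($x=t_{1,1}$): Step 1: start at $(i,j)=(1,1)$; while $(i+1,j)$ or $(i,j+1)$ is in the current shape: if $t_{i+1,j}\ge t_{i,j+1}+2$ ($\infty$ exceeding all integers) set $t_{i,j}=t_{i,j+1}$, $j=j+1$; otherwise set $t_{i,j}=t_{i+1,j}$,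 sort row $i$, $i=i+1$; finally delete cell $(i,j)$, giving $Y$, $\mu'$, row sums $(s_1,\dots,s_{l'})$. Step 2: as in insertion (with $x$ starting at the original $t_{1,1}$) except that the loop continues only while $y_{k,\mu'_k}\ge x+2$ and $y_{k,1}\le x+1$. Step 3: output $\mathrm{Fram}(\mu',s')$. -}

module Defs where

open import Data.Bool using (Bool; true; false; if_then_else_; _∧_; not)
open import Data.Nat as ℕ using (ℕ; zero; suc; _∸_)
open import Data.Integer as ℤ using (ℤ; +_; _+_; _-_; _≤ᵇ_; _/ℕ_; _%ℕ_)
import Data.Integer.Properties as ℤP
open import Data.List using (List; []; _∷_; _++_; [_]; length; map; take; drop; replicate; reverse; zipWith; foldr)
open import Data.Maybe using (Maybe; just; nothing)
open import Data.Product using (_×_; _,_)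
open import Data.Unit using (⊤)
open import Data.Empty using (⊥)
open import Relation.Nullary.Decidable using (⌊_⌋)
open import Relation.Binary.PropositionalEquality using (_≡_)

-- A tableau is a list of rows, row 1 (the bottom row) first; each row is
-- the list of its entries (t_{i,1}, ..., t_{i,μ_i}).  Entries are taken in
-- ℤ so that T - c and all intermediate quantities (a, d_k, s') are exact
-- (no truncated subtraction).  Off-diagram entries are ∞, which is handled
-- explicitly in each algorithm below.

Row : Set
Row = List ℤ

Tableau : Set
Tableau = List Row

sum : List ℤ → ℤ
sum = foldr _+_ (+ 0)

sortRow : Row → Row
sortRow = sort
  where open import Data.List.Sort.InsertionSort.Base ℤP.≤-decTotalOrder using (sort)

_==_ : ℤ → ℤ → Bool
a == b = ⌊ a ℤ.≟ b ⌋

_<ᵇ_ : ℤ → ℤ → Bool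
a <ᵇ b = (a + + 1) ≤ᵇ b

lastOr : ℤ → Row → ℤ
lastOr d []       = d
lastOr d (a ∷ []) = a
lastOr d (_ ∷ as) = lastOr d as

headOr : ℤ → Row → ℤ
headOr d []      = d
headOr d (a ∷ _) = a

shift : ℤ → Tableau → Tableau
shift c = map (map (λ t → t + c))

-- t_{1,1}; nothing encodes ∞ (empty diagram)
t11 : Tableau → Maybe ℤ
t11 []            = nothing
t11 ([] ∷ _)      = nothing
t11 ((a ∷ _) ∷ _) = just a

_≤t11_ : ℤ → Tableau → Set
y ≤t11 T with t11 T
... | nothing = ⊤
... | just a  = y ℤ.≤ a

-- Bcomp(c,m): the weakly increasing sequence of length m with sum c whose
-- max and min differ by at most 1: (m - r) copies of q then r copies of
-- q+1, where c = q m + r, 0 ≤ r < m (floor division).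

Bcomp : ℤ → ℕ → List ℤ
Bcomp c zero    = []
Bcomp c (suc m) =
  replicate (suc m ∸ (c %ℕ suc m)) (c /ℕ suc m)
  ++ replicate (c %ℕ suc m) ((c /ℕ suc m) + + 1)

-- r_{i,j} ≤ t_{i+1,j} - 2 for all j of the block (missing t_{i+1,j} = ∞)
blockOk : List ℤ → List ℤ → Bool
blockOk (r ∷ rs) (t ∷ ts) = (r ≤ᵇ (t - + 2)) ∧ blockOk rs ts
blockOk _        _        = true

-- blocks (μ_{k+1}, μ_k) for k = i, ..., r  (given μ_i, ..., μ_r; μ_{r+1} = 0)
blocksUp : List ℕ → List (ℕ × ℕ)
blocksUp []             = []
blocksUp (m ∷ [])       = (0 , m) ∷ []
blocksUp (m ∷ m' ∷ ms)  = (m' , m) ∷ blocksUp (m' ∷ ms)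

-- inner loop over k = r, ..., i (blocks given in that order), with the
-- current a and b and the row above (row i+1; [] if i = r).
framRowLoop : ℤ → ℕ → List (ℕ × ℕ) → Row → Row
framRowLoop a b []               above = []
framRowLoop a b ((lo , hi) ∷ bs) above =
  let w     = hi ∸ lo
      rs    = take w (Bcomp a b)
      tsUp  = take w (drop lo above)
      blk   = if blockOk rs tsUp then rs else map (λ t → t - + 2) tsUp
  in blk ++ framRowLoop (a - sum blk) (b ∸ w) bs above

framRows : List ℕ → List ℤ → Tableau
framRows []       _        = []
framRows (_ ∷ _)  []       = []
framRows (m ∷ ms) (c ∷ cs) with framRows ms cs
... | []            = framRowLoop c m (reverse (blocksUp (m ∷ ms))) [] ∷ []
... | rest@(up ∷ _) = framRowLoop c m (reverse (blocksUp (m ∷ ms))) up ∷ rest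

Fram : List ℕ → List ℤ → Tableau
Fram = framRows

framingNext : ℕ → ℤ → List ℕ → List ℤ → Set
framingNext m c (m' ∷ _) (c' ∷ _) = (m' ℕ.≤ m) × (m' ≡ m → c + + (2 ℕ.* m) ℤ.≤ c')
framingNext m c _        _        = ⊤

FramingFrom : ℕ → List ℕ → List ℤ → Set
FramingFrom i []       []       = ⊤
FramingFrom i (m ∷ ms) (c ∷ cs) =
  (1 ℕ.≤ m) × (+ ((2 ℕ.* i ∸ 1) ℕ.* m) ℤ.≤ c) × framingNext m c ms cs
  × FramingFrom (suc i) ms cs
FramingFrom i _        _        = ⊥

FramingCondition : List ℕ → List ℤ → Set
FramingCondition μ s = FramingFrom 1 μ s

data Framed (T : Tableau) : Set where
  framed : (μ : List ℕ) (s : List ℤ) → FramingCondition μ s → T ≡ Fram μ s → Framed T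

-- modify row k+1 from row k (for j ≤ μ'_{k+1}); lk = y_{k,μ'_k}
modifyRow : ℤ → ℤ → Row → Row → Row
modifyRow x lk (a ∷ as) (b ∷ bs) =
  (if a == x then x + + 2
   else if ((x + + 2) <ᵇ lk) ∧ (a == (x + + 1)) then x + + 3 else b)
  ∷ modifyRow x lk as bs
modifyRow x lk _        bs       = bs

-- returns (d_{k+1}, ..., d_{l'}) given x, the current row k, rows k+1.. of Y;
-- cond x rowk decides whether the loop continues.
step2Loop : (ℤ → Row → Bool) → ℤ → Row → Tableau → List ℤ
step2Loop cond x rowk []         = []
step2Loop cond x rowk (r ∷ rs) =
  if cond x rowk
  then (let r' = modifyRow x (lastOr x rowk) rowk r
        in (sum r - sum r') ∷ step2Loop cond (x + + 2) r' rs)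
  else map (λ _ → + 0) (r ∷ rs)

-- s'_k = s_k - d_k + d_{k+1}  (d_1 = d_{l'+1} = 0)
newSums : List ℤ → List ℤ → List ℤ
newSums s ds = zipWith (λ sk p → sk - Data.Product.proj₁ p + Data.Product.proj₂ p)
                       s (zipWith _,_ (+ 0 ∷ ds) (ds ++ [ + 0 ]))
  where import Data.Product

step2and3 : (ℤ → Row → Bool) → ℤ → Tableau → Tableau
step2and3 cond x0 []         = Fram [] []
step2and3 cond x0 (y1 ∷ ys)  =
  Fram (map length (y1 ∷ ys))
       (newSums (map sum (y1 ∷ ys)) (step2Loop cond x0 y1 ys))

replaceFirst : ℤ → Row → Row × ℤ
replaceFirst x []       = [] , x
replaceFirst x (a ∷ as) with (x + + 2) ≤ᵇ a
... | true  = (x ∷ as) , a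
... | false with replaceFirst x as
...   | (as' , y) = (a ∷ as') , y

bump : ℤ → Tableau → Tableau
bump x []           = [ [ x ] ]
bump x (row ∷ rows) with row
... | [] = sortRow (row ++ [ x ]) ∷ rows
... | (_ ∷ _) with (x + + 2) ≤ᵇ lastOr x row
...   | false = sortRow (row ++ [ x ]) ∷ rows
...   | true with replaceFirst x row
...     | (row' , y) = sortRow row' ∷ bump y rows

insCond : ℤ → Row → Bool
insCond x rowk = (x + + 2) ≤ᵇ lastOr x rowk

insert : Tableau → ℤ → Tableau
insert T x = step2and3 insCond x (bump x T)

-- entry at (0-based) position n of a row, nothing = ∞ (off the diagram)
at : ℕ → Row → Maybe ℤ
at n       []       = nothing
at zero    (a ∷ _)  = just a
at (suc n) (_ ∷ as) = at n as

caseM : Maybe ℤ → (ℤ → Tableau) → Tableau → Tableau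
caseM (just v) f d = f v
caseM nothing  f d = d

-- delete the hole: row i becomes pre (dropped if empty)
delRow : Row → Tableau → Tableau
delRow []        rest = rest
delRow (p ∷ pre) rest = (p ∷ pre) ∷ rest

-- slide above pre suf : row i = pre ++ [hole] ++ suf (hole at column
-- j = length pre + 1), above = rows i+1, ...;  returns rows i, i+1, ...
slide : Tableau → Row → Row → Tableau
slide []          pre []        = delRow pre []
slide []          pre (b ∷ suf) = slide [] (pre ++ [ b ]) suf
slide (a ∷ above) pre []        =
  -- (i,j+1) absent: move up if (i+1,j) present, else delete (i,j)
  caseM (at (length pre) a)
    (λ v → sortRow (pre ++ [ v ])
           ∷ slide above (take (length pre) a) (drop (suc (length pre)) a))
    (delRow pre (a ∷ above))
slide (a ∷ above) pre (b ∷ suf) =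
  -- both present: horizontal iff t_{i+1,j} ≥ t_{i,j+1} + 2 (∞ if absent)
  caseM (at (length pre) a)
    (λ v → if (b + + 2) ≤ᵇ v
           then slide (a ∷ above) (pre ++ [ b ]) suf
           else sortRow (pre ++ [ v ] ++ b ∷ suf)
                ∷ slide above (take (length pre) a) (drop (suc (length pre)) a))
    (slide (a ∷ above) (pre ++ [ b ]) suf)

removeStep1 : Tableau → Tableau
removeStep1 []              = []
removeStep1 ([] ∷ rows)     = rows
removeStep1 ((_ ∷ r) ∷ rows) = slide rows [] r

remCond : ℤ → Row → Bool
remCond x rowk = ((x + + 2) ≤ᵇ lastOr x rowk) ∧ (headOr x rowk ≤ᵇ (x + + 1))

remove : Tableau → Tableau
remove []              = []
remove ([] ∷ rows)     = []
remove ((x ∷ r) ∷ rows) = step2and3 remCond x (removeStep1 ((x ∷ r) ∷ rows))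

module Submission where

-- Every test made by insertion, removal and Fram compares two entries (or an
-- entry with x + k), and every arithmetic step adds or subtracts entries and
-- row sums, so translating T and x by c should translate the result by c.
-- The one delicate ingredient is Fram(μ, s): it satisfies
-- Fram(μ, s + μ c) = Fram(μ, s) + c only when μ is a partition, since its
-- bookkeeping needs every block to have the width prescribed by μ.

open import Defs
open import Data.Nat using (ℕ)
open import Data.Integer using (ℤ; +_; _+_; -_; _≤_)
open import Data.Maybe using (just)
open import Data.Product using (_×_)
open import Relation.Binary.PropositionalEquality using (_≡_)

open import Algebra.Bundles using (AbelianGroup)
open import Data.Maybe using (nothing) renaming (map to mapMaybe)
open import Data.Bool using (Bool; true; false; T; _∧_; if_then_else_)
open import Data.Empty using (⊥; ⊥-elim)
open import Data.Integer as ℤ using (_-_; _*_; _<_; _≤ᵇ_; _/ℕ_; _%ℕ_; +<+)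
import Data.Integer.DivMod as ℤD
import Data.Integer.Properties as ℤP
open import Data.Integer.Tactic.RingSolver using (solve-∀)
open import Data.List using (List; []; _∷_; _++_; [_]; length; map; take; drop; replicate; reverse; zipWith; foldr)
import Data.List.Properties as LP
open import Data.List.Relation.Unary.All as All using (All; []; _∷_)
import Data.List.Relation.Unary.All.Properties as AllP
open import Data.List.Relation.Unary.AllPairs as AllPairs using (AllPairs; []; _∷_)
open import Data.List.Relation.Unary.Any using (here; there)
open import Data.List.Membership.Propositional using (_∈_)
import Data.List.Relation.Unary.AllPairs.Properties as AllPairsP
open import Data.List.Relation.Binary.Permutation.Propositional.Properties using (↭-length)
open import Data.List.Sort.InsertionSort.Base ℤP.≤-decTotalOrder using () renaming (insert to insertSorted)
open import Data.List.Sort.InsertionSort.Properties ℤP.≤-decTotalOrder using (sort-↭)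
open import Data.Nat as ℕ using (zero; suc; _∸_; z≤n; s≤s)
import Data.Nat.Properties as ℕP
open import Data.Product using (_,_; proj₁; proj₂)
open import Data.Sum using (_⊎_; inj₁; inj₂)
open import Data.Unit using (⊤; tt)
open import Function using (_∘_; mk⇔)
open import Relation.Nullary using (does; yes; no)
open import Relation.Nullary.Decidable using (does-⇔; isYes≗does; T?)
open import Relation.Binary.PropositionalEquality using (_≢_; refl; sym; trans; cong; cong₂; subst; subst₂; module ≡-Reasoning)

open import Algebra.Properties.Group (AbelianGroup.group ℤP.+-0-abelianGroup) using (∙-cancelʳ)

shiftRow : ℤ → Row → Row
shiftRow c = map (λ t → t + c)

shift-cancel : ∀ x T → shift (+ x) (shift (- (+ x)) T) ≡ T
shift-cancel x T = trans (sym (LP.map-∘ T)) (LP.map-id-local (All.universal cancelRow T))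
  where
  cancelRow : ∀ r → shiftRow (+ x) (shiftRow (- (+ x)) r) ≡ r
  cancelRow r = trans (sym (LP.map-∘ r)) (LP.map-id-local (All.universal (λ t → cancel t (+ x)) r))
    where
    cancel : ∀ t y → t + - y + y ≡ t
    cancel = solve-∀

sum-++ : ∀ xs ys → sum (xs ++ ys) ≡ sum xs + sum ys
sum-++ []       ys = sym (ℤP.+-identityˡ (sum ys))
sum-++ (x ∷ xs) ys = trans (cong (λ s → x + s) (sum-++ xs ys)) (sym (ℤP.+-assoc x (sum xs) (sum ys)))

sum-replicate : ∀ k x → sum (replicate k x) ≡ + k * x
sum-replicate zero    x = sym (ℤP.*-zeroˡ x)
sum-replicate (suc k) x = trans (cong (λ s → x + s) (sum-replicate k x)) (sym (ℤP.suc-* (+ k) x))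

sum-shiftRow : ∀ c xs → sum (shiftRow c xs) ≡ sum xs + + length xs * c
sum-shiftRow c []       = sym (ℤP.*-zeroˡ c)
sum-shiftRow c (x ∷ xs) = begin
  x + c + sum (shiftRow c xs)           ≡⟨ cong (λ s → x + c + s) (sum-shiftRow c xs) ⟩
  x + c + (sum xs + + length xs * c)    ≡⟨ regroup x (sum xs) (+ length xs) c ⟩
  x + sum xs + (c + + length xs * c)    ≡⟨ cong (λ s → x + sum xs + s) (sym (ℤP.suc-* (+ length xs) c)) ⟩
  x + sum xs + + suc (length xs) * c    ∎
  where
  open ≡-Reasoning
  regroup : ∀ a b n c → a + c + (b + n * c) ≡ a + b + (c + n * c)
  regroup = solve-∀

+-cancelʳ-≡ : ∀ {i j} k → i + k ≡ j + k → i ≡ j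
+-cancelʳ-≡ {i} {j} k = ∙-cancelʳ k i j

+-cancelʳ-≤ : ∀ {i j} k → i + k ≤ j + k → i ≤ j
+-cancelʳ-≤ {i} {j} k i+k≤j+k = subst₂ _≤_ (cancel i k) (cancel j k) (ℤP.+-monoˡ-≤ (- k) i+k≤j+k)
  where
  cancel : ∀ i k → i + k + - k ≡ i
  cancel = solve-∀

T-ext : ∀ {b b′ : Bool} → (T b → T b′) → (T b′ → T b) → b ≡ b′
T-ext f g = does-⇔ (mk⇔ f g) (T? _) (T? _)

≤ᵇ-shift : ∀ c a b → ((a + c) ≤ᵇ (b + c)) ≡ (a ≤ᵇ b)
≤ᵇ-shift c a b = T-ext (λ p → ℤP.≤⇒≤ᵇ (+-cancelʳ-≤ {a} {b} c (ℤP.≤ᵇ⇒≤ {a + c} {b + c} p)))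
                       (λ p → ℤP.≤⇒≤ᵇ (ℤP.+-monoˡ-≤ c {a} {b} (ℤP.≤ᵇ⇒≤ {a} {b} p)))

-- The tests "a + k ≤ b" of the algorithms (k = 1 for _<ᵇ_, k = 2 for bumping).
offset-≤ᵇ-shift : ∀ c k a b → ((a + c + k) ≤ᵇ (b + c)) ≡ ((a + k) ≤ᵇ b)
offset-≤ᵇ-shift c k a b = trans (cong (_≤ᵇ (b + c)) (swap a c k)) (≤ᵇ-shift c (a + k) b)
  where
  swap : ∀ a c k → a + c + k ≡ a + k + c
  swap = solve-∀

<ᵇ-shift : ∀ c a b → ((a + c) <ᵇ (b + c)) ≡ (a <ᵇ b)
<ᵇ-shift c = offset-≤ᵇ-shift c (+ 1)

==-shift : ∀ c a b → ((a + c) == (b + c)) ≡ (a == b)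
==-shift c a b = begin
  (a + c) == (b + c)              ≡⟨ isYes≗does _ ⟩
  does ((a + c) ℤ.≟ (b + c))      ≡⟨ does-⇔ (mk⇔ (+-cancelʳ-≡ c) (cong (_+ c))) ((a + c) ℤ.≟ (b + c)) (a ℤ.≟ b) ⟩
  does (a ℤ.≟ b)                  ≡⟨ sym (isYes≗does _) ⟩
  a == b                          ∎
  where open ≡-Reasoning

≤?-shift : ∀ c a b → does ((a + c) ℤ.≤? (b + c)) ≡ does (a ℤ.≤? b)
≤?-shift c a b = does-⇔ (mk⇔ (+-cancelʳ-≤ c) (ℤP.+-monoˡ-≤ c)) ((a + c) ℤ.≤? (b + c)) (a ℤ.≤? b)

insertSorted-shift : ∀ c x xs → insertSorted (x + c) (shiftRow c xs) ≡ shiftRow c (insertSorted x xs)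
insertSorted-shift c x []       = refl
insertSorted-shift c x (y ∷ xs) rewrite ≤?-shift c x y with does (x ℤ.≤? y)
... | true  = refl
... | false = cong (y + c ∷_) (insertSorted-shift c x xs)

sortRow-shift : ∀ c xs → sortRow (shiftRow c xs) ≡ shiftRow c (sortRow xs)
sortRow-shift c []       = refl
sortRow-shift c (x ∷ xs) =
  trans (cong (insertSorted (x + c)) (sortRow-shift c xs)) (insertSorted-shift c x (sortRow xs))

length-sortRow : ∀ xs → length (sortRow xs) ≡ length xs
length-sortRow xs = ↭-length (sort-↭ xs)

lastOr-shift : ∀ c d xs → lastOr (d + c) (shiftRow c xs) ≡ lastOr d xs + c
lastOr-shift c d []             = refl
lastOr-shift c d (a ∷ [])       = refl
lastOr-shift c d (a ∷ a′ ∷ as) = lastOr-shift c d (a′ ∷ as)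

headOr-shift : ∀ c d xs → headOr (d + c) (shiftRow c xs) ≡ headOr d xs + c
headOr-shift c d []      = refl
headOr-shift c d (a ∷ _) = refl

-- Bcomp c m is always the "even" list  evenList q m r  (m - r copies of q
-- followed by r copies of q + 1, r ≤ m), and conversely every even list is
-- the balanced composition of its own sum and length.

evenList : ℤ → ℕ → ℕ → List ℤ
evenList q m r = replicate (m ∸ r) q ++ replicate r (q + + 1)

quotient-bounds : ∀ a q r n → r ℕ.< n → a ≡ + r + q * + n → q * + n ≤ a × a < ℤ.suc q * + n
quotient-bounds a q r n r<n refl =
  ℤP.i≤j+i (q * + n) (+ r) ,
  subst (λ z → + r + q * + n < z) (sym (ℤP.suc-* q (+ n))) (ℤP.+-monoˡ-< (q * + n) (+<+ r<n))

quotient-≤ : ∀ a q q′ n → q * + n ≤ a → a < ℤ.suc q′ * + n → q ≤ q′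
quotient-≤ a q q′ n qn≤a a<q′n =
  subst (q ≤_) (ℤP.pred-suc q′)
    (ℤP.i<j⇒i≤pred[j] {j = ℤ.suc q′} (ℤP.*-cancelʳ-<-nonNeg {i = q} {j = ℤ.suc q′} (+ n) (ℤP.≤-<-trans qn≤a a<q′n)))

divMod-unique : ∀ a q r n .{{_ : ℕ.NonZero n}} → r ℕ.< n → a ≡ + r + q * + n → a /ℕ n ≡ q × a %ℕ n ≡ r
divMod-unique a q r n r<n a≡r+qn = q≡ , r≡
  where
  given = quotient-bounds a q r n r<n a≡r+qn
  actual = quotient-bounds a (a /ℕ n) (a %ℕ n) n (ℤD.n%ℕd<d a n) (ℤD.a≡a%ℕn+[a/ℕn]*n a n)
  q≡ : a /ℕ n ≡ q
  q≡ = ℤP.≤-antisym (quotient-≤ a _ _ n (proj₁ actual) (proj₂ given)) (quotient-≤ a _ _ n (proj₁ given) (proj₂ actual))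
  r≡ : a %ℕ n ≡ r
  r≡ = ℤP.+-injective (+-cancelʳ-≡ (q * + n)
         (trans (cong (λ z → + (a %ℕ n) + z * + n) (sym q≡)) (trans (sym (ℤD.a≡a%ℕn+[a/ℕn]*n a n)) a≡r+qn)))

Bcomp-evenList : ∀ m q r → r ℕ.≤ m → Bcomp (+ r + q * + m) m ≡ evenList q m r
Bcomp-evenList zero    q zero z≤n = refl
Bcomp-evenList (suc n) q r r≤m with r ℕ.≟ suc n
... | no r≢m with divMod-unique (+ r + q * + suc n) q r (suc n) (ℕP.≤∧≢⇒< r≤m r≢m) refl
...   | q≡ , r≡ rewrite q≡ | r≡ = refl
Bcomp-evenList (suc n) q r r≤m | yes refl
  with divMod-unique (+ 0 + (q + + 1) * + suc n) (q + + 1) 0 (suc n) (s≤s z≤n) refl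
... | q≡ , r≡ = begin
  Bcomp (+ suc n + q * + suc n) (suc n)          ≡⟨ cong (λ z → Bcomp z (suc n)) (carry (+ suc n) q) ⟩
  Bcomp (+ 0 + (q + + 1) * + suc n) (suc n)      ≡⟨ cong₂ (λ u v → replicate (suc n ∸ v) u ++ replicate v (u + + 1)) q≡ r≡ ⟩
  replicate (suc n) (q + + 1) ++ []              ≡⟨ LP.++-identityʳ _ ⟩
  replicate (suc n) (q + + 1)                    ≡⟨ cong (λ k → replicate k q ++ replicate (suc n) (q + + 1)) (sym (ℕP.n∸n≡0 n)) ⟩
  evenList q (suc n) (suc n)                     ∎
  where
  open ≡-Reasoning
  carry : ∀ m q → m + q * m ≡ + 0 + (q + + 1) * m
  carry = solve-∀

record IsEven (D : List ℤ) : Set where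
  constructor isEven
  field
    q   : ℤ
    m   : ℕ
    r   : ℕ
    r≤m : r ℕ.≤ m
    D≡  : D ≡ evenList q m r

length-evenList : ∀ q m r → r ℕ.≤ m → length (evenList q m r) ≡ m
length-evenList q m r r≤m = begin
  length (evenList q m r)                                       ≡⟨ LP.length-++ (replicate (m ∸ r) q) ⟩
  length (replicate (m ∸ r) q) ℕ.+ length (replicate r (q + + 1)) ≡⟨ cong₂ ℕ._+_ (LP.length-replicate (m ∸ r)) (LP.length-replicate r) ⟩
  m ∸ r ℕ.+ r                                                   ≡⟨ ℕP.m∸n+n≡m r≤m ⟩
  m                                                             ∎
  where open ≡-Reasoning

sum-evenList : ∀ q m r → r ℕ.≤ m → sum (evenList q m r) ≡ + r + q * + m
sum-evenList q m r r≤m = begin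
  sum (evenList q m r)                     ≡⟨ sum-++ (replicate (m ∸ r) q) _ ⟩
  sum (replicate (m ∸ r) q) + sum (replicate r (q + + 1))
                                           ≡⟨ cong₂ _+_ (sum-replicate (m ∸ r) q) (sum-replicate r _) ⟩
  + (m ∸ r) * q + + r * (q + + 1)          ≡⟨ collect (+ (m ∸ r)) (+ r) q ⟩
  + r + q * (+ (m ∸ r) + + r)              ≡⟨ cong (λ z → + r + q * z) (sym (ℤP.pos-+ (m ∸ r) r)) ⟩
  + r + q * + (m ∸ r ℕ.+ r)                ≡⟨ cong (λ z → + r + q * + z) (ℕP.m∸n+n≡m r≤m) ⟩
  + r + q * + m                            ∎
  where
  open ≡-Reasoning
  collect : ∀ d r q → d * q + r * (q + + 1) ≡ r + q * (d + r)
  collect = solve-∀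

Bcomp-isEven : ∀ a n → IsEven (Bcomp a n)
Bcomp-isEven a zero    = isEven (+ 0) 0 0 z≤n refl
Bcomp-isEven a (suc n) = isEven (a /ℕ suc n) (suc n) (a %ℕ suc n) (ℕP.<⇒≤ (ℤD.n%ℕd<d a (suc n))) refl

Bcomp-of-even : ∀ D → IsEven D → Bcomp (sum D) (length D) ≡ D
Bcomp-of-even D (isEven q m r r≤m refl)
  rewrite sum-evenList q m r r≤m | length-evenList q m r r≤m = Bcomp-evenList m q r r≤m

isEven-tail : ∀ D → IsEven D → IsEven (drop 1 D)
isEven-tail D (isEven q zero zero z≤n refl) = isEven q 0 0 z≤n refl
isEven-tail D (isEven q (suc m) r r≤1+m refl) with r ℕ.≤? m
... | yes r≤m =
  isEven q m r r≤m (cong (λ k → drop 1 (replicate k q ++ replicate r (q + + 1))) (ℕP.+-∸-assoc 1 r≤m))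
... | no r≰m with ℕP.≤-antisym r≤1+m (ℕP.≰⇒> r≰m)
...   | refl = isEven q m m ℕP.≤-refl
  (trans (cong (λ k → drop 1 (replicate k q ++ replicate (suc m) (q + + 1))) (ℕP.n∸n≡0 m))
         (cong (λ k → replicate k q ++ replicate m (q + + 1)) (sym (ℕP.n∸n≡0 m))))

isEven-drop : ∀ w D → IsEven D → IsEven (drop w D)
isEven-drop zero    D       e = e
isEven-drop (suc w) []      e = e
isEven-drop (suc w) (x ∷ D) e = isEven-drop w D (isEven-tail (x ∷ D) e)

isEven-shift : ∀ c D → IsEven D → IsEven (shiftRow c D)
isEven-shift c D (isEven q m r r≤m refl) = isEven (q + c) m r r≤m (begin
  shiftRow c (evenList q m r)                                       ≡⟨ LP.map-++ _ (replicate (m ∸ r) q) _ ⟩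
  shiftRow c (replicate (m ∸ r) q) ++ shiftRow c (replicate r (q + + 1))
                                   ≡⟨ cong₂ _++_ (LP.map-replicate _ (m ∸ r) q) (LP.map-replicate _ r _) ⟩
  replicate (m ∸ r) (q + c) ++ replicate r (q + + 1 + c)           ≡⟨ cong (λ z → replicate (m ∸ r) (q + c) ++ replicate r z) (swap q c) ⟩
  evenList (q + c) m r                                              ∎)
  where
  open ≡-Reasoning
  swap : ∀ q c → q + + 1 + c ≡ q + c + + 1
  swap = solve-∀

length-Bcomp : ∀ a b → length (Bcomp a b) ≡ b
length-Bcomp a zero    = refl
length-Bcomp a (suc n) = length-evenList (a /ℕ suc n) (suc n) (a %ℕ suc n) (ℕP.<⇒≤ (ℤD.n%ℕd<d a (suc n)))

sum-Bcomp : ∀ a b → 0 ℕ.< b → sum (Bcomp a b) ≡ a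
sum-Bcomp a (suc n) _ =
  trans (sum-evenList (a /ℕ suc n) (suc n) (a %ℕ suc n) (ℕP.<⇒≤ (ℤD.n%ℕd<d a (suc n))))
        (sym (ℤD.a≡a%ℕn+[a/ℕn]*n a (suc n)))

Bcomp-shift : ∀ a b c → Bcomp (a + + b * c) b ≡ shiftRow c (Bcomp a b)
Bcomp-shift a zero    c = refl
Bcomp-shift a (suc n) c =
  trans (cong₂ Bcomp sum≡ length≡) (Bcomp-of-even _ (isEven-shift c _ (Bcomp-isEven a (suc n))))
  where
  C = Bcomp a (suc n)
  length≡ : suc n ≡ length (shiftRow c C)
  length≡ = sym (trans (LP.length-map _ C) (length-Bcomp a (suc n)))
  sum≡ : a + + suc n * c ≡ sum (shiftRow c C)
  sum≡ = sym (trans (sum-shiftRow c C)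
                    (cong₂ (λ u v → u + + v * c) (sum-Bcomp a (suc n) (s≤s z≤n)) (length-Bcomp a (suc n))))

Bcomp-suffix : ∀ a b w → w ℕ.≤ b → Bcomp (a - sum (take w (Bcomp a b))) (b ∸ w) ≡ drop w (Bcomp a b)
Bcomp-suffix a zero    zero z≤n = refl
Bcomp-suffix a (suc n) w w≤b =
  trans (cong₂ Bcomp sum≡ length≡) (Bcomp-of-even _ (isEven-drop w C (Bcomp-isEven a (suc n))))
  where
  C = Bcomp a (suc n)
  length≡ : suc n ∸ w ≡ length (drop w C)
  length≡ = sym (trans (LP.length-drop w C) (cong (_∸ w) (length-Bcomp a (suc n))))
  split : a ≡ sum (take w C) + sum (drop w C)
  split = trans (sym (sum-Bcomp a (suc n) (s≤s z≤n))) (trans (cong sum (sym (LP.take++drop≡id w C))) (sum-++ (take w C) _))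
  cancel : ∀ x y → x + y - x ≡ y
  cancel = solve-∀
  sum≡ : a - sum (take w C) ≡ sum (drop w C)
  sum≡ = trans (cong (_- sum (take w C)) split) (cancel (sum (take w C)) _)

Sorted : Row → Set
Sorted = AllPairs _≤_

_≼_ : Row → Row → Set
xs ≼ ys = All (λ x → All (x ≤_) ys) xs

_≪_ : Row → Row → Set
xs ≪ ys = All (λ x → All (λ y → x + + 2 ≤ y) ys) xs

Balanced : Row → Set
Balanced xs = All (λ x → All (λ y → y ≤ x + + 1) xs) xs

Between : ℤ → Row → Set
Between q xs = All (λ x → q ≤ x × x ≤ q + + 1) xs

Sorted-replicate : ∀ k x → Sorted (replicate k x)
Sorted-replicate zero    x = []
Sorted-replicate (suc k) x = AllP.replicate⁺ k ℤP.≤-refl ∷ Sorted-replicate k x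

Sorted-evenList : ∀ q m r → Sorted (evenList q m r)
Sorted-evenList q m r = AllPairsP.++⁺ (Sorted-replicate (m ∸ r) q) (Sorted-replicate r _)
  (AllP.replicate⁺ (m ∸ r) (AllP.replicate⁺ r (ℤP.i≤i+j q (+ 1))))

Between-evenList : ∀ q m r → Between q (evenList q m r)
Between-evenList q m r = AllP.++⁺ (AllP.replicate⁺ (m ∸ r) (ℤP.≤-refl , ℤP.i≤i+j q (+ 1)))
                                 (AllP.replicate⁺ r (ℤP.i≤i+j q (+ 1) , ℤP.≤-refl))

Between⇒Balanced : ∀ q xs → Between q xs → Balanced xs
Between⇒Balanced q xs inQ =
  All.map (λ q≤x → All.map (λ y≤q+1 → ℤP.≤-trans (proj₂ y≤q+1) (ℤP.+-monoˡ-≤ (+ 1) (proj₁ q≤x))) inQ) inQ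

Sorted-Bcomp : ∀ a b → Sorted (Bcomp a b)
Sorted-Bcomp a b with Bcomp-isEven a b
... | isEven q m r _ e rewrite e = Sorted-evenList q m r

Balanced-Bcomp : ∀ a b → Balanced (Bcomp a b)
Balanced-Bcomp a b with Bcomp-isEven a b
... | isEven q m r _ e rewrite e = Between⇒Balanced q _ (Between-evenList q m r)

Bcomp-lowerBound : ∀ l a b → l * + b ≤ a → All (l ≤_) (Bcomp a b)
Bcomp-lowerBound l a zero    lb≤a = []
Bcomp-lowerBound l a (suc n) lb≤a =
  All.map (λ inQ → ℤP.≤-trans l≤q (proj₁ inQ)) (Between-evenList q (suc n) (a %ℕ suc n))
  where
  q = a /ℕ suc n
  bounds = quotient-bounds a q (a %ℕ suc n) (suc n) (ℤD.n%ℕd<d a (suc n)) (ℤD.a≡a%ℕn+[a/ℕn]*n a (suc n))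
  l≤q : l ≤ q
  l≤q = quotient-≤ a l q (suc n) lb≤a (proj₂ bounds)

-- framRowLoop walks over blocks (lo, hi) of consecutive columns.  Only the
-- widths hi - lo matter, together with the row above read from column lo
-- on; rowLoop is this width-based form of the loop.

lower2 : Row → Row
lower2 = map (λ t → t - + 2)

block : ℤ → ℕ → ℕ → Row → Row
block a b w A =
  if blockOk (take w (Bcomp a b)) (take w A) then take w (Bcomp a b) else lower2 (take w A)

rowLoop : ℤ → ℕ → List ℕ → Row → Row
rowLoop a b []       A = []
rowLoop a b (w ∷ ws) A = block a b w A ++ rowLoop (a - sum (block a b w A)) (b ∸ w) ws (drop w A)

Covers : ℕ → Row → Set
Covers w A = length (take w A) ≡ w ⊎ A ≡ []

Aligned : ℕ → List ℕ → Row → Set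
Aligned b []       A = ⊤
Aligned b (w ∷ ws) A = (w ℕ.≤ b) × Covers w A × Aligned (b ∸ w) ws (drop w A)

length-take-≤ : ∀ w (xs : List ℤ) → w ℕ.≤ length xs → length (take w xs) ≡ w
length-take-≤ w xs w≤ = trans (LP.length-take w xs) (ℕP.m≤n⇒m⊓n≡m w≤)

length-take-Bcomp : ∀ a b w → w ℕ.≤ b → length (take w (Bcomp a b)) ≡ w
length-take-Bcomp a b w w≤b = length-take-≤ w (Bcomp a b) (subst (w ℕ.≤_) (sym (length-Bcomp a b)) w≤b)

blockOk-[] : ∀ rs → blockOk rs [] ≡ true
blockOk-[] []       = refl
blockOk-[] (r ∷ rs) = refl

length-block : ∀ a b w A → w ℕ.≤ b → Covers w A → length (block a b w A) ≡ w
length-block a b w A  w≤b (inj₁ covered) with blockOk (take w (Bcomp a b)) (take w A)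
... | true  = length-take-Bcomp a b w w≤b
... | false = trans (LP.length-map _ (take w A)) covered
length-block a b w [] w≤b (inj₂ refl)
  rewrite LP.take-[] {A = ℤ} w | blockOk-[] (take w (Bcomp a b)) = length-take-Bcomp a b w w≤b

sumWidths : List ℕ → ℕ
sumWidths = foldr ℕ._+_ 0

length-rowLoop : ∀ a b ws A → Aligned b ws A → length (rowLoop a b ws A) ≡ sumWidths ws
length-rowLoop a b []       A tt                    = refl
length-rowLoop a b (w ∷ ws) A (w≤b , covers , rest) =
  trans (LP.length-++ (block a b w A))
        (cong₂ ℕ._+_ (length-block a b w A w≤b covers) (length-rowLoop _ (b ∸ w) ws (drop w A) rest))

blockOk-shift : ∀ c rs ts → blockOk (shiftRow c rs) (shiftRow c ts) ≡ blockOk rs ts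
blockOk-shift c []       ts       = refl
blockOk-shift c (r ∷ rs) []       = refl
blockOk-shift c (r ∷ rs) (t ∷ ts) =
  cong₂ _∧_ (trans (cong ((r + c) ≤ᵇ_) (swap t c)) (≤ᵇ-shift c r (t - + 2))) (blockOk-shift c rs ts)
  where
  swap : ∀ t c → t + c - + 2 ≡ t - + 2 + c
  swap = solve-∀

lower2-shift : ∀ c ts → lower2 (shiftRow c ts) ≡ shiftRow c (lower2 ts)
lower2-shift c []       = refl
lower2-shift c (t ∷ ts) = cong₂ _∷_ (swap t c) (lower2-shift c ts)
  where
  swap : ∀ t c → t + c - + 2 ≡ t - + 2 + c
  swap = solve-∀

block-shift : ∀ a b c w A → block (a + + b * c) b w (shiftRow c A) ≡ shiftRow c (block a b w A)
block-shift a b c w A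
  rewrite Bcomp-shift a b c | LP.take-map {f = λ t → t + c} w (Bcomp a b) | LP.take-map {f = λ t → t + c} w A
        | blockOk-shift c (take w (Bcomp a b)) (take w A)
  with blockOk (take w (Bcomp a b)) (take w A)
... | true  = refl
... | false = lower2-shift c (take w A)

rowLoop-shift : ∀ a b c ws A → Aligned b ws A →
  rowLoop (a + + b * c) b ws (shiftRow c A) ≡ shiftRow c (rowLoop a b ws A)
rowLoop-shift a b c []       A tt                    = refl
rowLoop-shift a b c (w ∷ ws) A (w≤b , covers , rest) = begin
  block (a + + b * c) b w (shiftRow c A) ++ rowLoop a′ (b ∸ w) ws (drop w (shiftRow c A))
    ≡⟨ cong₂ (λ u v → u ++ rowLoop v (b ∸ w) ws (drop w (shiftRow c A))) (block-shift a b c w A) a′≡ ⟩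
  shiftRow c B ++ rowLoop (a - sum B + + (b ∸ w) * c) (b ∸ w) ws (drop w (shiftRow c A))
    ≡⟨ cong (λ v → shiftRow c B ++ rowLoop (a - sum B + + (b ∸ w) * c) (b ∸ w) ws v) (LP.drop-map w A) ⟩
  shiftRow c B ++ rowLoop (a - sum B + + (b ∸ w) * c) (b ∸ w) ws (shiftRow c (drop w A))
    ≡⟨ cong (shiftRow c B ++_) (rowLoop-shift (a - sum B) (b ∸ w) c ws (drop w A) rest) ⟩
  shiftRow c B ++ shiftRow c (rowLoop (a - sum B) (b ∸ w) ws (drop w A))
    ≡⟨ sym (LP.map-++ _ B _) ⟩
  shiftRow c (rowLoop a b (w ∷ ws) A) ∎
  where
  open ≡-Reasoning
  B = block a b w A
  a′ = a + + b * c - sum (block (a + + b * c) b w (shiftRow c A))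
  regroup : ∀ a s d w c → a + (d + w) * c - (s + w * c) ≡ a - s + d * c
  regroup = solve-∀
  a′≡ : a′ ≡ a - sum B + + (b ∸ w) * c
  a′≡ = begin
    a′                                          ≡⟨ cong (λ z → a + + b * c - sum z) (block-shift a b c w A) ⟩
    a + + b * c - sum (shiftRow c B)            ≡⟨ cong (λ z → a + + b * c - z) (sum-shiftRow c B) ⟩
    a + + b * c - (sum B + + length B * c)      ≡⟨ cong (λ z → a + + b * c - (sum B + + z * c)) (length-block a b w A w≤b covers) ⟩
    a + + b * c - (sum B + + w * c)             ≡⟨ cong (λ z → a + + z * c - (sum B + + w * c)) (sym (ℕP.m∸n+n≡m w≤b)) ⟩
    a + + (b ∸ w ℕ.+ w) * c - (sum B + + w * c) ≡⟨ cong (λ z → a + z * c - (sum B + + w * c)) (ℤP.pos-+ (b ∸ w) w) ⟩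
    a + (+ (b ∸ w) + + w) * c - (sum B + + w * c) ≡⟨ regroup a (sum B) (+ (b ∸ w)) (+ w) c ⟩
    a - sum B + + (b ∸ w) * c                   ∎

Chained : ℕ → List (ℕ × ℕ) → Set
Chained lo []             = ⊤
Chained lo ((l , h) ∷ bs) = l ≡ lo × l ℕ.≤ h × Chained h bs

chainEnd : ℕ → List (ℕ × ℕ) → ℕ
chainEnd lo []             = lo
chainEnd lo ((l , h) ∷ bs) = chainEnd h bs

widths : List (ℕ × ℕ) → List ℕ
widths = map (λ p → proj₂ p ∸ proj₁ p)

Chained-++ : ∀ lo xs ys → Chained lo xs → Chained (chainEnd lo xs) ys → Chained lo (xs ++ ys)
Chained-++ lo []             ys tt                 c = c
Chained-++ lo ((l , h) ∷ xs) ys (l≡ , l≤h , c) c′ = l≡ , l≤h , Chained-++ h xs ys c c′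

framRowLoop-widths : ∀ lo bs a b above → Chained lo bs →
  framRowLoop a b bs above ≡ rowLoop a b (widths bs) (drop lo above)
framRowLoop-widths lo []               a b above tt                 = refl
framRowLoop-widths lo ((.lo , h) ∷ bs) a b above (refl , lo≤h , c) =
  cong (block a b (h ∸ lo) (drop lo above) ++_)
    (trans (framRowLoop-widths h bs _ _ above c)
      (cong (rowLoop _ _ (widths bs))
        (trans (cong (λ k → drop k above) (sym (ℕP.m+[n∸m]≡n lo≤h))) (sym (LP.drop-drop lo (h ∸ lo) above)))))

NonIncreasing : List ℕ → Set
NonIncreasing (a ∷ b ∷ l) = b ℕ.≤ a × NonIncreasing (b ∷ l)
NonIncreasing _           = ⊤

NonIncreasing-tail : ∀ m ms → NonIncreasing (m ∷ ms) → NonIncreasing ms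
NonIncreasing-tail m []       p = tt
NonIncreasing-tail m (_ ∷ ms) p = proj₂ p

firstPart : List ℕ → ℕ
firstPart []      = 0
firstPart (m ∷ _) = m

firstPart-≤ : ∀ m ms → NonIncreasing (m ∷ ms) → firstPart ms ℕ.≤ m
firstPart-≤ m []       p = z≤n
firstPart-≤ m (_ ∷ ms) p = proj₁ p

-- The block widths μ_r, μ_{r-1} - μ_r, ..., μ_i - μ_{i+1} used for row i.
rowWidths : List ℕ → List ℕ
rowWidths []       = []
rowWidths (m ∷ ms) = rowWidths ms ++ [ m ∸ firstPart ms ]

sumWidths-++ : ∀ xs ys → sumWidths (xs ++ ys) ≡ sumWidths xs ℕ.+ sumWidths ys
sumWidths-++ []       ys = refl
sumWidths-++ (x ∷ xs) ys = trans (cong (x ℕ.+_) (sumWidths-++ xs ys)) (sym (ℕP.+-assoc x _ _))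

sumWidths-rowWidths : ∀ ms → NonIncreasing ms → sumWidths (rowWidths ms) ≡ firstPart ms
sumWidths-rowWidths []       p = refl
sumWidths-rowWidths (m ∷ ms) p = begin
  sumWidths (rowWidths ms ++ [ m ∸ firstPart ms ])          ≡⟨ sumWidths-++ (rowWidths ms) _ ⟩
  sumWidths (rowWidths ms) ℕ.+ (m ∸ firstPart ms ℕ.+ 0)     ≡⟨ cong₂ ℕ._+_ (sumWidths-rowWidths ms (NonIncreasing-tail m ms p)) (ℕP.+-identityʳ _) ⟩
  firstPart ms ℕ.+ (m ∸ firstPart ms)                       ≡⟨ ℕP.m+[n∸m]≡n (firstPart-≤ m ms p) ⟩
  m                                                         ∎
  where open ≡-Reasoning

blocksUp-chained : ∀ m ms → NonIncreasing (m ∷ ms) →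
  Chained 0 (reverse (blocksUp (m ∷ ms))) × chainEnd 0 (reverse (blocksUp (m ∷ ms))) ≡ m
  × widths (reverse (blocksUp (m ∷ ms))) ≡ rowWidths (m ∷ ms)
blocksUp-chained m []         p = (refl , z≤n , tt) , refl , refl
blocksUp-chained m (m′ ∷ ms) (m′≤m , p) with blocksUp-chained m′ ms p
... | chained , end , ws rewrite LP.unfold-reverse (m′ , m) (blocksUp (m′ ∷ ms)) =
  Chained-++ 0 R _ chained (subst (λ z → Chained z ((m′ , m) ∷ [])) (sym end) (refl , m′≤m , tt)) ,
  end-++ 0 R ,
  trans (LP.map-++ _ R _) (cong (_++ [ m ∸ m′ ]) ws)
  where
  R = reverse (blocksUp (m′ ∷ ms))
  end-++ : ∀ lo xs → chainEnd lo (xs ++ (m′ , m) ∷ []) ≡ m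
  end-++ lo []             = refl
  end-++ lo ((l , h) ∷ xs) = end-++ h xs

framRowLoop≡rowLoop : ∀ m ms a A → NonIncreasing (m ∷ ms) →
  framRowLoop a m (reverse (blocksUp (m ∷ ms))) A ≡ rowLoop a m (rowWidths (m ∷ ms)) A
framRowLoop≡rowLoop m ms a A p with blocksUp-chained m ms p
... | chained , _ , ws = trans (framRowLoop-widths 0 _ a m A chained) (cong (λ z → rowLoop a m z A) ws)

firstRow : Tableau → Row
firstRow []      = []
firstRow (r ∷ _) = r

firstRow-shift : ∀ c T → firstRow (shift c T) ≡ shiftRow c (firstRow T)
firstRow-shift c []      = refl
firstRow-shift c (r ∷ T) = refl

framRows-step : ∀ m ms c cs → framRows (m ∷ ms) (c ∷ cs)
  ≡ framRowLoop c m (reverse (blocksUp (m ∷ ms))) (firstRow (framRows ms cs)) ∷ framRows ms cs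
framRows-step m ms c cs with framRows ms cs
... | []    = refl
... | _ ∷ _ = refl

FirstRowLength : List ℕ → Tableau → Set
FirstRowLength (m ∷ _) (r ∷ _) = length r ≡ m
FirstRowLength _       _       = ⊤

firstRow-framRows : ∀ ms ss → FirstRowLength ms (framRows ms ss) →
  length (firstRow (framRows ms ss)) ≡ firstPart ms ⊎ firstRow (framRows ms ss) ≡ []
firstRow-framRows []        ss len = inj₂ refl
firstRow-framRows (m′ ∷ ms) ss len with framRows (m′ ∷ ms) ss
... | []    = inj₂ refl
... | _ ∷ _ = inj₁ len

aligned-snoc : ∀ ws w b A → sumWidths ws ℕ.+ w ℕ.≤ b → (length A ≡ sumWidths ws ⊎ A ≡ []) → Aligned b (ws ++ [ w ]) A
aligned-snoc []       w b A w≤b            fits = w≤b , covers A fits , tt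
  where
  covers : ∀ A → (length A ≡ 0 ⊎ A ≡ []) → Covers w A
  covers A  (inj₂ A≡[]) = inj₂ A≡[]
  covers [] (inj₁ _)    = inj₂ refl
aligned-snoc (v ∷ ws) w b A v+ws+w≤b fits =
  ℕP.≤-trans (ℕP.m≤m+n v _) v+[ws+w]≤b ,
  covers fits ,
  aligned-snoc ws w (b ∸ v) (drop v A) ws+w≤b-v (rest fits)
  where
  v+[ws+w]≤b : v ℕ.+ (sumWidths ws ℕ.+ w) ℕ.≤ b
  v+[ws+w]≤b = subst (ℕ._≤ b) (ℕP.+-assoc v _ w) v+ws+w≤b
  ws+w≤b-v : sumWidths ws ℕ.+ w ℕ.≤ b ∸ v
  ws+w≤b-v = subst (ℕ._≤ b ∸ v) (ℕP.m+n∸m≡n v _) (ℕP.∸-monoˡ-≤ v v+[ws+w]≤b)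
  covers : (length A ≡ v ℕ.+ sumWidths ws ⊎ A ≡ []) → Covers v A
  covers (inj₂ A≡[]) = inj₂ A≡[]
  covers (inj₁ len)  = inj₁ (length-take-≤ v A (subst (v ℕ.≤_) (sym len) (ℕP.m≤m+n v _)))
  rest : (length A ≡ v ℕ.+ sumWidths ws ⊎ A ≡ []) → length (drop v A) ≡ sumWidths ws ⊎ drop v A ≡ []
  rest (inj₂ refl) = inj₂ (LP.drop-[] v)
  rest (inj₁ len)  = inj₁ (trans (LP.length-drop v A) (trans (cong (_∸ v) len) (ℕP.m+n∸m≡n v _)))

rowAligned : ∀ m ms ss → NonIncreasing (m ∷ ms) → FirstRowLength ms (framRows ms ss) →
  Aligned m (rowWidths (m ∷ ms)) (firstRow (framRows ms ss))
rowAligned m ms ss p len = aligned-snoc (rowWidths ms) (m ∸ firstPart ms) m _ fits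
  (subst (λ n → length (firstRow (framRows ms ss)) ≡ n ⊎ firstRow (framRows ms ss) ≡ []) (sym (sumWidths-rowWidths ms p′)) (firstRow-framRows ms ss len))
  where
  p′ = NonIncreasing-tail m ms p
  fits : sumWidths (rowWidths ms) ℕ.+ (m ∸ firstPart ms) ℕ.≤ m
  fits = ℕP.≤-reflexive (trans (cong (ℕ._+ (m ∸ firstPart ms)) (sumWidths-rowWidths ms p′)) (ℕP.m+[n∸m]≡n (firstPart-≤ m ms p)))

length-framRow : ∀ m ms x ss → NonIncreasing (m ∷ ms) → FirstRowLength ms (framRows ms ss) →
  length (framRowLoop x m (reverse (blocksUp (m ∷ ms))) (firstRow (framRows ms ss))) ≡ m
length-framRow m ms x ss p len = begin
  length (framRowLoop x m (reverse (blocksUp (m ∷ ms))) A) ≡⟨ cong length (framRowLoop≡rowLoop m ms x A p) ⟩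
  length (rowLoop x m (rowWidths (m ∷ ms)) A)              ≡⟨ length-rowLoop x m _ A (rowAligned m ms ss p len) ⟩
  sumWidths (rowWidths (m ∷ ms))                           ≡⟨ sumWidths-rowWidths (m ∷ ms) p ⟩
  m                                                        ∎
  where
  open ≡-Reasoning
  A = firstRow (framRows ms ss)

FirstRowLength-framRows : ∀ μ s → NonIncreasing μ → FirstRowLength μ (framRows μ s)
FirstRowLength-framRows []       s        p = tt
FirstRowLength-framRows (m ∷ ms) []       p = tt
FirstRowLength-framRows (m ∷ ms) (x ∷ ss) p rewrite framRows-step m ms x ss =
  length-framRow m ms x ss p (FirstRowLength-framRows ms ss (NonIncreasing-tail m ms p))

-- Row sums s_i + μ_i c: the row sums of T + c when T has shape μ and row sums s.
shiftSums : ℤ → List ℕ → List ℤ → List ℤ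
shiftSums c (m ∷ ms) (s ∷ ss) = (s + + m * c) ∷ shiftSums c ms ss
shiftSums c _        _        = []

Fram-shift : ∀ μ s c → NonIncreasing μ → framRows μ (shiftSums c μ s) ≡ shift c (framRows μ s)
Fram-shift []       s        c p = refl
Fram-shift (m ∷ ms) []       c p = refl
Fram-shift (m ∷ ms) (x ∷ ss) c p = begin
  framRows (m ∷ ms) (x + + m * c ∷ shiftSums c ms ss)
    ≡⟨ framRows-step m ms _ _ ⟩
  framRowLoop (x + + m * c) m B (firstRow (framRows ms (shiftSums c ms ss))) ∷ framRows ms (shiftSums c ms ss)
    ≡⟨ cong (λ G → framRowLoop (x + + m * c) m B (firstRow G) ∷ G) (Fram-shift ms ss c p′) ⟩
  framRowLoop (x + + m * c) m B (firstRow (shift c F)) ∷ shift c F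
    ≡⟨ cong (λ R → framRowLoop (x + + m * c) m B R ∷ shift c F) (firstRow-shift c F) ⟩
  framRowLoop (x + + m * c) m B (shiftRow c A) ∷ shift c F
    ≡⟨ cong (_∷ shift c F) rowShift ⟩
  shiftRow c (framRowLoop x m B A) ∷ shift c F
    ≡⟨ cong (shift c) (sym (framRows-step m ms x ss)) ⟩
  shift c (framRows (m ∷ ms) (x ∷ ss)) ∎
  where
  open ≡-Reasoning
  p′ = NonIncreasing-tail m ms p
  F = framRows ms ss
  A = firstRow F
  B = reverse (blocksUp (m ∷ ms))
  rowShift : framRowLoop (x + + m * c) m B (shiftRow c A) ≡ shiftRow c (framRowLoop x m B A)
  rowShift = begin
    framRowLoop (x + + m * c) m B (shiftRow c A)  ≡⟨ framRowLoop≡rowLoop m ms _ (shiftRow c A) p ⟩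
    rowLoop (x + + m * c) m (rowWidths (m ∷ ms)) (shiftRow c A)
      ≡⟨ rowLoop-shift x m c _ A (rowAligned m ms ss p (FirstRowLength-framRows ms ss p′)) ⟩
    shiftRow c (rowLoop x m (rowWidths (m ∷ ms)) A) ≡⟨ cong (shiftRow c) (sym (framRowLoop≡rowLoop m ms x A p)) ⟩
    shiftRow c (framRowLoop x m B A)              ∎

-- Row i is built block by block; a block is either a piece of a balanced
-- composition, or (when that piece is not two below the row above) the row
-- above lowered by 2.  The key point is that in the second case the lowered
-- block still lies below everything the loop produces afterwards.

ColumnGap : Row → Row → Set
ColumnGap (x ∷ xs) (y ∷ ys) = x + + 2 ≤ y × ColumnGap xs ys
ColumnGap _        _        = ⊤

BlocksBalanced : List ℕ → Row → Set
BlocksBalanced []       xs = ⊤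
BlocksBalanced (w ∷ ws) xs = Balanced (take w xs) × BlocksBalanced ws (drop w xs)

≤-by-sum₁ : ∀ {x y a₁ b₁} → a₁ ≤ b₁ → y - x ≡ b₁ - a₁ → x ≤ y
≤-by-sum₁ h e = ℤP.0≤i-j⇒j≤i (subst (+ 0 ≤_) (sym e) (ℤP.i≤j⇒0≤j-i h))

≤-by-sum₂ : ∀ {x y a₁ b₁ a₂ b₂} → a₁ ≤ b₁ → a₂ ≤ b₂ → y - x ≡ (b₁ - a₁) + (b₂ - a₂) → x ≤ y
≤-by-sum₂ h₁ h₂ e = ℤP.0≤i-j⇒j≤i (subst (+ 0 ≤_) (sym e) (ℤP.+-mono-≤ (ℤP.i≤j⇒0≤j-i h₁) (ℤP.i≤j⇒0≤j-i h₂)))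

≤-by-sum₃ : ∀ {x y a₁ b₁ a₂ b₂ a₃ b₃} → a₁ ≤ b₁ → a₂ ≤ b₂ → a₃ ≤ b₃ →
  y - x ≡ (b₁ - a₁) + (b₂ - a₂) + (b₃ - a₃) → x ≤ y
≤-by-sum₃ h₁ h₂ h₃ e = ℤP.0≤i-j⇒j≤i (subst (+ 0 ≤_) (sym e)
  (ℤP.+-mono-≤ (ℤP.+-mono-≤ (ℤP.i≤j⇒0≤j-i h₁) (ℤP.i≤j⇒0≤j-i h₂)) (ℤP.i≤j⇒0≤j-i h₃)))

Sorted-++⁻ : ∀ xs {ys} → Sorted (xs ++ ys) → xs ≼ ys
Sorted-++⁻ []       s          = []
Sorted-++⁻ (x ∷ xs) (x≤ ∷ s) = AllP.++⁻ʳ xs x≤ ∷ Sorted-++⁻ xs s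

take≼drop : ∀ w xs → Sorted xs → take w xs ≼ drop w xs
take≼drop w xs s = Sorted-++⁻ (take w xs) (subst Sorted (sym (LP.take++drop≡id w xs)) s)

Balanced-take : ∀ w xs → Balanced xs → Balanced (take w xs)
Balanced-take w xs b = AllP.take⁺ w (All.map (AllP.take⁺ w) b)

Balanced-tail : ∀ x xs → Balanced (x ∷ xs) → Balanced xs
Balanced-tail x xs (_ ∷ b) = All.map (λ { (_ ∷ a) → a }) b

Sorted-lower2 : ∀ xs → Sorted xs → Sorted (lower2 xs)
Sorted-lower2 xs s = AllPairsP.map⁺ (AllPairs.map (ℤP.+-monoˡ-≤ (- + 2)) s)

Balanced-lower2 : ∀ xs → Balanced xs → Balanced (lower2 xs)
Balanced-lower2 xs b = AllP.map⁺ (All.map (λ {x} a → AllP.map⁺ (All.map (λ {y} h → ≤-by-sum₁ h (shift2 x y)) a)) b)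
  where
  shift2 : ∀ x y → x - + 2 + + 1 - (y - + 2) ≡ x + + 1 - y
  shift2 = solve-∀

sum-lowerBound : ∀ x D → All (x ≤_) D → + length D * x ≤ sum D
sum-lowerBound x []      []       = ℤP.≤-reflexive (ℤP.*-zeroˡ x)
sum-lowerBound x (d ∷ D) (h ∷ hs) =
  subst (_≤ d + sum D) (sym (ℤP.suc-* (+ length D) x)) (ℤP.+-mono-≤ h (sum-lowerBound x D hs))

take-++-exact : ∀ w (xs ys : List ℤ) → length xs ≡ w → take w (xs ++ ys) ≡ xs
take-++-exact .0                   []       ys refl = refl
take-++-exact .(suc (length xs)) (x ∷ xs) ys refl = cong (x ∷_) (take-++-exact _ xs ys refl)

drop-++-exact : ∀ w (xs ys : List ℤ) → length xs ≡ w → drop w (xs ++ ys) ≡ ys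
drop-++-exact .0                   []       ys refl = refl
drop-++-exact .(suc (length xs)) (x ∷ xs) ys refl = drop-++-exact _ xs ys refl

ColumnGap-[] : ∀ xs → ColumnGap xs []
ColumnGap-[] []      = tt
ColumnGap-[] (_ ∷ _) = tt

ColumnGap-++ : ∀ xs ys xs′ ys′ → ColumnGap xs ys → length xs ≡ length ys → ColumnGap xs′ ys′ →
  ColumnGap (xs ++ xs′) (ys ++ ys′)
ColumnGap-++ []       []       xs′ ys′ g         e g′ = g′
ColumnGap-++ (x ∷ xs) (y ∷ ys) xs′ ys′ (x≪y , g) e g′ = x≪y , ColumnGap-++ xs ys xs′ ys′ g (ℕP.suc-injective e) g′

ColumnGap-lower2 : ∀ ts → ColumnGap (lower2 ts) ts
ColumnGap-lower2 []       = tt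
ColumnGap-lower2 (t ∷ ts) = ℤP.≤-reflexive (cancel t) , ColumnGap-lower2 ts
  where
  cancel : ∀ t → t - + 2 + + 2 ≡ t
  cancel = solve-∀

data Violation : Row → Row → Set where
  this-column  : ∀ {r t rs ts} → t - + 2 + + 1 ≤ r → Violation (r ∷ rs) (t ∷ ts)
  later-column : ∀ {r t rs ts} → Violation rs ts → Violation (r ∷ rs) (t ∷ ts)

≤ᵇ-false : ∀ r u → (r ≤ᵇ u) ≡ false → u + + 1 ≤ r
≤ᵇ-false r u e =
  subst (_≤ r) (ℤP.+-comm (+ 1) u) (ℤP.i<j⇒suc[i]≤j (ℤP.≰⇒> (λ r≤u → subst T e (ℤP.≤⇒≤ᵇ r≤u))))

violation : ∀ rs ts → blockOk rs ts ≡ false → Violation rs ts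
violation []       ts       ()
violation (r ∷ rs) []       ()
violation (r ∷ rs) (t ∷ ts) e with r ≤ᵇ (t - + 2) in e₁
... | false = this-column (≤ᵇ-false r (t - + 2) e₁)
... | true  = later-column (violation rs ts e)

Violation-nonempty : ∀ rs ts → Violation rs ts → 0 ℕ.< length rs
Violation-nonempty (r ∷ rs) (t ∷ ts) _ = s≤s z≤n

record ViolatingPair (rs ts : Row) : Set where
  constructor violatingPair
  field
    r* t* : ℤ
    r*∈   : r* ∈ rs
    t*∈   : t* ∈ ts
    t*<r* : t* - + 2 + + 1 ≤ r*

violatingPair-of : ∀ {rs ts} → Violation rs ts → ViolatingPair rs ts
violatingPair-of (this-column h) = violatingPair _ _ (here refl) (here refl) h
violatingPair-of (later-column v) with violatingPair-of v
... | violatingPair r* t* r*∈ t*∈ h = violatingPair r* t* (there r*∈) (there t*∈) h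

data Lowered≤ : Row → Row → Set where
  []  : Lowered≤ [] []
  _∷_ : ∀ {t r ts rs} → t - + 2 ≤ r → Lowered≤ ts rs → Lowered≤ (t ∷ ts) (r ∷ rs)

Lowered≤-const : ∀ r ts rs → length ts ≡ length rs → All (λ t → t - + 2 ≤ r) ts → All (r ≤_) rs → Lowered≤ ts rs
Lowered≤-const r []       []       e []       []         = []
Lowered≤-const r (t ∷ ts) (x ∷ rs) e (a ∷ as) (r≤x ∷ bs) = ℤP.≤-trans a r≤x ∷ Lowered≤-const r ts rs (ℕP.suc-injective e) as bs

-- One violating column forces t_j - 2 ≤ r_j in every column (both rows sorted and balanced):
-- left of it r_j ≥ r* - 1 ≥ t* - 2 ≥ t_j - 2, right of it r_j ≥ r* ≥ t* - 1 ≥ t_j - 2.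
violation⇒Lowered≤ : ∀ rs ts → length ts ≡ length rs → Violation rs ts → Sorted rs → Sorted ts →
  Balanced rs → Balanced ts → Lowered≤ ts rs
violation⇒Lowered≤ (r ∷ rs) (t ∷ ts) e (this-column h) (r≤ ∷ _) _ _ bt =
  ≤-by-sum₂ h (ℤ.+≤+ {0} {1} z≤n) (diff t r) ∷
  Lowered≤-const r ts rs (ℕP.suc-injective e)
    (All.map (λ {t′} h′ → ≤-by-sum₂ h′ h (diff′ t t′ r)) (All.tail (All.lookup bt (here refl)))) r≤
  where
  diff : ∀ t r → r - (t - + 2) ≡ (r - (t - + 2 + + 1)) + (+ 1 - + 0)
  diff = solve-∀
  diff′ : ∀ t t′ r → r - (t′ - + 2) ≡ (t + + 1 - t′) + (r - (t - + 2 + + 1))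
  diff′ = solve-∀
violation⇒Lowered≤ (r ∷ rs) (t ∷ ts) e (later-column v) (_ ∷ sr) (t≤ ∷ st) br bt with violatingPair-of v
... | violatingPair r* t* r*∈ t*∈ h =
  ≤-by-sum₃ (All.lookup t≤ t*∈) h (All.lookup (All.lookup br (here refl)) (there r*∈)) (diff t t* r* r) ∷
  violation⇒Lowered≤ rs ts (ℕP.suc-injective e) v sr st (Balanced-tail r rs br) (Balanced-tail t ts bt)
  where
  diff : ∀ t t* r* r → r - (t - + 2) ≡ (t* - t) + (r* - (t* - + 2 + + 1)) + (r + + 1 - r*)
  diff = solve-∀

sum-Lowered≤ : ∀ {ts rs} → Lowered≤ ts rs → sum (lower2 ts) ≤ sum rs
sum-Lowered≤ []       = ℤP.≤-refl
sum-Lowered≤ (h ∷ hs) = ℤP.+-mono-≤ h (sum-Lowered≤ hs)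

failedBlock-below : ∀ a b w ts → w ℕ.≤ b → length ts ≡ w → Sorted ts → Balanced ts →
  blockOk (take w (Bcomp a b)) ts ≡ false → lower2 ts ≼ Bcomp (a - sum (lower2 ts)) (b ∸ w)
failedBlock-below a b w ts w≤b lenTs sortedTs balancedTs fails =
  AllP.map⁺ (All.map (λ {tk} → remainder-above tk) suffix-above)
  where
  C = Bcomp a b
  rs = take w C
  D = drop w C
  v = violation rs ts fails
  open ViolatingPair (violatingPair-of v)
  a′ = a - sum (lower2 ts)
  -- Every part after the block is at least r* ≥ t* - 1 ≥ t_k - 2.
  suffix-above : All (λ tk → All (λ d → tk - + 2 ≤ d) D) ts
  suffix-above =
    All.map (λ {tk} tk≤ → All.map (λ {d} r*≤d → ≤-by-sum₃ tk≤ t*<r* r*≤d (diff tk t* r* d))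
                                  (All.lookup (take≼drop w C (Sorted-Bcomp a b)) r*∈))
            (All.lookup balancedTs t*∈)
    where
    diff : ∀ tk t* r* d → d - (tk - + 2) ≡ (t* + + 1 - tk) + (r* - (t* - + 2 + + 1)) + (d - r*)
    diff = solve-∀
  lowered-cost : sum (lower2 ts) ≤ sum rs
  lowered-cost = sum-Lowered≤ (violation⇒Lowered≤ rs ts (trans lenTs (sym (length-take-Bcomp a b w w≤b))) v
    (AllPairsP.take⁺ w (Sorted-Bcomp a b)) sortedTs (Balanced-take w C (Balanced-Bcomp a b)) balancedTs)
  sum-D : sum D ≡ a - sum rs
  sum-D = begin
    sum D                      ≡⟨ sym (cancel (sum rs) (sum D)) ⟩
    sum rs + sum D - sum rs    ≡⟨ cong (_- sum rs) (sym (sum-++ rs D)) ⟩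
    sum (rs ++ D) - sum rs     ≡⟨ cong (λ z → sum z - sum rs) (LP.take++drop≡id w C) ⟩
    sum C - sum rs             ≡⟨ cong (_- sum rs) (sum-Bcomp a b 0<b) ⟩
    a - sum rs                 ∎
    where
    open ≡-Reasoning
    cancel : ∀ x y → x + y - x ≡ y
    cancel = solve-∀
    0<b : 0 ℕ.< b
    0<b = ℕP.<-≤-trans (Violation-nonempty rs ts v) (ℕP.≤-trans (ℕP.≤-reflexive (length-take-Bcomp a b w w≤b)) w≤b)
  sum-D≤a′ : sum D ≤ a′
  sum-D≤a′ = subst (_≤ a′) (sym sum-D) (≤-by-sum₁ lowered-cost (diff a (sum (lower2 ts)) (sum rs)))
    where
    diff : ∀ a s t → a - s - (a - t) ≡ t - s
    diff = solve-∀
  remainder-above : ∀ tk → All (λ d → tk - + 2 ≤ d) D → All (tk - + 2 ≤_) (Bcomp a′ (b ∸ w))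
  remainder-above tk D-above = Bcomp-lowerBound (tk - + 2) a′ (b ∸ w) (ℤP.≤-trans
    (subst (λ n → (tk - + 2) * + n ≤ sum D) (trans (LP.length-drop w C) (cong (_∸ w) (length-Bcomp a b)))
      (subst (_≤ sum D) (ℤP.*-comm (+ length D) _) (sum-lowerBound _ D D-above)))
    sum-D≤a′)

blockOk⇒ColumnGap : ∀ rs ts → blockOk rs ts ≡ true → ColumnGap rs ts
blockOk⇒ColumnGap []       ts       e = tt
blockOk⇒ColumnGap (r ∷ rs) []       e = tt
blockOk⇒ColumnGap (r ∷ rs) (t ∷ ts) e with r ≤ᵇ (t - + 2) in e₁
... | true  = ≤-by-sum₁ (ℤP.≤ᵇ⇒≤ {r} {t - + 2} (subst T (sym e₁) tt)) (diff r t) , blockOk⇒ColumnGap rs ts e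
  where
  diff : ∀ r t → t - (r + + 2) ≡ t - + 2 - r
  diff = solve-∀

ColumnGap⇒≪ : ∀ rs ts ys → ColumnGap rs ts → length rs ℕ.≤ length ts → ts ≼ ys → rs ≪ ys
ColumnGap⇒≪ []       ts       ys g         l       p       = []
ColumnGap⇒≪ (r ∷ rs) (t ∷ ts) ys (r≪t , g) (s≤s l) (t≤ ∷ p) =
  All.map (ℤP.≤-trans r≪t) t≤ ∷ ColumnGap⇒≪ rs ts ys g l p

lower2-≪ : ∀ ts ys → ts ≼ ys → lower2 ts ≪ ys
lower2-≪ ts ys p = AllP.map⁺ (All.map (All.map (ℤP.≤-trans (ℤP.≤-reflexive (cancel _)))) p)
  where
  cancel : ∀ t → t - + 2 + + 2 ≡ t
  cancel = solve-∀

≪⇒≼lower2 : ∀ P ts → P ≪ ts → P ≼ lower2 ts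
≪⇒≼lower2 P ts p = All.map (λ {x} a → AllP.map⁺ (All.map (λ {t} h → ≤-by-sum₁ h (diff x t)) a)) p
  where
  diff : ∀ x t → t - + 2 - x ≡ t - (x + + 2)
  diff = solve-∀

≼-trans-nonempty : ∀ P B Q → 0 ℕ.< length B → P ≼ B → B ≼ Q → P ≼ Q
≼-trans-nonempty P (x ∷ B) Q _ p (x≤ ∷ _) = All.map (λ ≤x → All.map (ℤP.≤-trans (All.head ≤x)) x≤) p

≼-[] : ∀ P → P ≼ []
≼-[] P = All.universal (λ _ → []) P

record BlockFacts (a : ℤ) (b w : ℕ) (A P B : Row) : Set where
  field
    sorted      : Sorted B
    balanced    : Balanced B
    length≡     : length B ≡ w
    above-P     : P ≼ B
    below-rest  : (P ++ B) ≼ Bcomp (a - sum B) (b ∸ w)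
    below-above : B ≪ drop w A
    gap         : ∀ out → ColumnGap out (drop w A) → ColumnGap (B ++ out) A

okBlockFacts : ∀ a b w A P → w ℕ.≤ b → Covers w A → Sorted A → P ≼ Bcomp a b →
  blockOk (take w (Bcomp a b)) (take w A) ≡ true → BlockFacts a b w A P (take w (Bcomp a b))
okBlockFacts a b w A P w≤b covers sortedA P≼C ok = record
  { sorted      = AllPairsP.take⁺ w (Sorted-Bcomp a b)
  ; balanced    = Balanced-take w C (Balanced-Bcomp a b)
  ; length≡     = length-rs
  ; above-P     = All.map (AllP.take⁺ w) P≼C
  ; below-rest  = subst ((P ++ rs) ≼_) (sym (Bcomp-suffix a b w w≤b))
                    (AllP.++⁺ (All.map (AllP.drop⁺ w) P≼C) (take≼drop w C (Sorted-Bcomp a b)))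
  ; below-above = below-above covers
  ; gap         = gap covers
  }
  where
  C = Bcomp a b
  rs = take w C
  length-rs = length-take-Bcomp a b w w≤b
  rs≪ts = blockOk⇒ColumnGap rs (take w A) ok
  below-above : Covers w A → rs ≪ drop w A
  below-above (inj₁ lenTs) =
    ColumnGap⇒≪ rs (take w A) (drop w A) rs≪ts (ℕP.≤-reflexive (trans length-rs (sym lenTs))) (take≼drop w A sortedA)
  below-above (inj₂ refl)  = subst (rs ≪_) (sym (LP.drop-[] w)) (All.universal (λ _ → []) rs)
  gap : Covers w A → ∀ out → ColumnGap out (drop w A) → ColumnGap (rs ++ out) A
  gap (inj₁ lenTs) out g =
    subst (ColumnGap (rs ++ out)) (LP.take++drop≡id w A) (ColumnGap-++ rs (take w A) out (drop w A) rs≪ts (trans length-rs (sym lenTs)) g)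
  gap (inj₂ refl)  out g = ColumnGap-[] (rs ++ out)

failedBlockFacts : ∀ a b w A P → w ℕ.≤ b → Covers w A → Sorted A → Balanced (take w A) → P ≼ Bcomp a b → P ≪ A →
  blockOk (take w (Bcomp a b)) (take w A) ≡ false → BlockFacts a b w A P (lower2 (take w A))
failedBlockFacts a b w A P w≤b covers sortedA balancedTs P≼C P≪A fails = record
  { sorted      = Sorted-lower2 ts (AllPairsP.take⁺ w sortedA)
  ; balanced    = Balanced-lower2 ts balancedTs
  ; length≡     = length-B
  ; above-P     = P≼B
  ; below-rest  = AllP.++⁺ (≼-trans-nonempty P B _ (subst (0 ℕ.<_) (sym length-B) 0<w) P≼B B≼rest) B≼rest
  ; below-above = lower2-≪ ts (drop w A) (take≼drop w A sortedA)
  ; gap         = λ out g → subst (ColumnGap (B ++ out)) (LP.take++drop≡id w A)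
                    (ColumnGap-++ B ts out (drop w A) (ColumnGap-lower2 ts) (LP.length-map _ ts) g)
  }
  where
  ts = take w A
  B = lower2 ts
  -- An ended row above would make the block test succeed.
  covered : Covers w A → length ts ≡ w
  covered (inj₁ len)  = len
  covered (inj₂ A≡[]) = ⊥-elim (true≢false (begin
    true                                     ≡⟨ sym (blockOk-[] (take w (Bcomp a b))) ⟩
    blockOk (take w (Bcomp a b)) []          ≡⟨ cong (blockOk (take w (Bcomp a b))) (sym (LP.take-[] w)) ⟩
    blockOk (take w (Bcomp a b)) (take w []) ≡⟨ cong (λ z → blockOk (take w (Bcomp a b)) (take w z)) (sym A≡[]) ⟩
    blockOk (take w (Bcomp a b)) ts          ≡⟨ fails ⟩
    false                                    ∎))
    where
    open ≡-Reasoning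
    true≢false : true ≡ false → ⊥
    true≢false ()
  lenTs : length ts ≡ w
  lenTs = covered covers
  length-B : length B ≡ w
  length-B = trans (LP.length-map _ ts) lenTs
  0<w : 0 ℕ.< w
  0<w = subst (0 ℕ.<_) (length-take-Bcomp a b w w≤b) (Violation-nonempty (take w (Bcomp a b)) ts (violation _ ts fails))
  P≼B : P ≼ B
  P≼B = ≪⇒≼lower2 P ts (All.map (AllP.take⁺ w) P≪A)
  B≼rest : B ≼ Bcomp (a - sum B) (b ∸ w)
  B≼rest = failedBlock-below a b w ts w≤b lenTs (AllPairsP.take⁺ w sortedA) balancedTs fails

blockFacts : ∀ a b w A P → w ℕ.≤ b → Covers w A → Sorted A → Balanced (take w A) → P ≼ Bcomp a b → P ≪ A →
  BlockFacts a b w A P (block a b w A)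
blockFacts a b w A P w≤b covers sortedA balancedTs P≼C P≪A with blockOk (take w (Bcomp a b)) (take w A) in test
... | true  = okBlockFacts a b w A P w≤b covers sortedA P≼C test
... | false = failedBlockFacts a b w A P w≤b covers sortedA balancedTs P≼C P≪A test

RowFacts : ℤ → ℕ → List ℕ → Row → Row → Set
RowFacts a b ws A P = let out = rowLoop a b ws A in
  Sorted out × P ≼ out × BlocksBalanced ws out × ColumnGap out A

rowLoop-facts : ∀ ws a b A P → Aligned b ws A → Sorted A → BlocksBalanced ws A → P ≼ Bcomp a b → P ≪ A →
  RowFacts a b ws A P
rowLoop-facts []       a b A P tt                         _       _                       _   _   = [] , ≼-[] P , tt , tt
rowLoop-facts (w ∷ ws) a b A P (w≤b , covers , aligned) sortedA (balancedTs , balancedA) P≼C P≪A =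
  AllPairsP.++⁺ sorted sorted-out (AllP.++⁻ʳ P P++B≼out) ,
  All.zipWith (λ (p , q) → AllP.++⁺ p q) (above-P , AllP.++⁻ˡ P P++B≼out) ,
  (subst Balanced (sym (take-++-exact w B out length≡)) balanced ,
   subst (BlocksBalanced ws) (sym (drop-++-exact w B out length≡)) balanced-out) ,
  gap out gap-out
  where
  B = block a b w A
  open BlockFacts (blockFacts a b w A P w≤b covers sortedA balancedTs P≼C P≪A)
  out = rowLoop (a - sum B) (b ∸ w) ws (drop w A)
  rest = rowLoop-facts ws (a - sum B) (b ∸ w) (drop w A) (P ++ B) aligned (AllPairsP.drop⁺ w sortedA) balancedA
           below-rest (AllP.++⁺ (All.map (AllP.drop⁺ w) P≪A) below-above)
  sorted-out = proj₁ rest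
  P++B≼out = proj₁ (proj₂ rest)
  balanced-out = proj₁ (proj₂ (proj₂ rest))
  gap-out = proj₂ (proj₂ (proj₂ rest))

-- If row r′ (the row above r) is as long as r, then every entry of r is at
-- least 2 below the last entry of r′.  This is what keeps the shape a
-- partition when an entry of r is bumped into r′.
Dominated : Row → Row → Set
Dominated r r′ = length r′ ≡ length r → All (λ z → z + + 2 ≤ lastOr z r′) r

WellStacked : Tableau → Set
WellStacked []             = ⊤
WellStacked (r ∷ [])       = Sorted r
WellStacked (r ∷ r′ ∷ rs) = Sorted r × Dominated r r′ × WellStacked (r′ ∷ rs)

≤lastOr : ∀ d y ys → Sorted (y ∷ ys) → y ≤ lastOr d (y ∷ ys)
≤lastOr d y []         s              = ℤP.≤-refl
≤lastOr d y (y′ ∷ ys) ((y≤y′ ∷ _) ∷ s) = ℤP.≤-trans y≤y′ (≤lastOr d y′ ys s)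

ColumnGap⇒lastOr : ∀ xs ys → ColumnGap xs ys → length xs ℕ.≤ length ys → Sorted ys →
  All (λ z → z + + 2 ≤ lastOr z ys) xs
ColumnGap⇒lastOr []       ys       g         l       s = []
ColumnGap⇒lastOr (x ∷ xs) (y ∷ ys) (x≪y , g) (s≤s l) s@(_ ∷ sys) =
  ℤP.≤-trans x≪y (≤lastOr x y ys s) ∷ rest xs ys g l sys
  where
  rest : ∀ xs ys → ColumnGap xs ys → length xs ℕ.≤ length ys → Sorted ys →
    All (λ z → z + + 2 ≤ lastOr z (y ∷ ys)) xs
  rest []        ys         g l s = []
  rest (_ ∷ _)  []          g () s
  rest xs@(_ ∷ _) ys@(_ ∷ _) g l s = ColumnGap⇒lastOr xs ys g l s

BlocksBalanced-[] : ∀ ws → BlocksBalanced ws []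
BlocksBalanced-[] []       = tt
BlocksBalanced-[] (w ∷ ws) = subst Balanced (sym (LP.take-[] w)) [] , subst (BlocksBalanced ws) (sym (LP.drop-[] w)) (BlocksBalanced-[] ws)

-- A further block beyond the end of the row is empty, hence balanced.
BlocksBalanced-snoc : ∀ ws w A → BlocksBalanced ws A → (length A ≡ sumWidths ws ⊎ A ≡ []) → BlocksBalanced (ws ++ [ w ]) A
BlocksBalanced-snoc []       w A _ fits = subst Balanced (sym (take-empty A fits)) [] , tt
  where
  take-empty : ∀ A → (length A ≡ 0 ⊎ A ≡ []) → take w A ≡ []
  take-empty []      _          = LP.take-[] w
  take-empty (_ ∷ A) (inj₁ ())
  take-empty (_ ∷ A) (inj₂ ())
BlocksBalanced-snoc (v ∷ ws) w A (b , bb) fits = b , BlocksBalanced-snoc ws w (drop v A) bb (rest fits)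
  where
  rest : (length A ≡ v ℕ.+ sumWidths ws ⊎ A ≡ []) → length (drop v A) ≡ sumWidths ws ⊎ drop v A ≡ []
  rest (inj₂ A≡[]) = inj₂ (trans (cong (drop v) A≡[]) (LP.drop-[] v))
  rest (inj₁ len)  = inj₁ (trans (LP.length-drop v A) (trans (cong (_∸ v) len) (ℕP.m+n∸m≡n v _)))

WellStacked-head : ∀ T → WellStacked T → Sorted (firstRow T)
WellStacked-head []             _ = []
WellStacked-head (r ∷ [])       s = s
WellStacked-head (r ∷ r′ ∷ T) s = proj₁ s

WellStacked-cons : ∀ r T → Sorted r → ColumnGap r (firstRow T) → WellStacked T → WellStacked (r ∷ T)
WellStacked-cons r []        s g _  = s
WellStacked-cons r (r′ ∷ T) s g sT =
  s , (λ e → ColumnGap⇒lastOr r r′ g (ℕP.≤-reflexive (sym e)) (WellStacked-head (r′ ∷ T) sT)) , sT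

framRows-wellStacked : ∀ μ s → NonIncreasing μ →
  WellStacked (framRows μ s) × BlocksBalanced (rowWidths μ) (firstRow (framRows μ s))
framRows-wellStacked []       s        p = tt , tt
framRows-wellStacked (m ∷ ms) []       p = tt , BlocksBalanced-[] (rowWidths (m ∷ ms))
framRows-wellStacked (m ∷ ms) (x ∷ ss) p rewrite framRows-step m ms x ss =
  WellStacked-cons row F sorted-row gap-row (proj₁ below) , balanced-row
  where
  p′ = NonIncreasing-tail m ms p
  below = framRows-wellStacked ms ss p′
  F = framRows ms ss
  A = firstRow F
  row = framRowLoop x m (reverse (blocksUp (m ∷ ms))) A
  fits = subst (λ n → length A ≡ n ⊎ A ≡ []) (sym (sumWidths-rowWidths ms p′))
           (firstRow-framRows ms ss (FirstRowLength-framRows ms ss p′))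
  facts : RowFacts x m (rowWidths (m ∷ ms)) A []
  facts = rowLoop-facts (rowWidths (m ∷ ms)) x m A [] (rowAligned m ms ss p (FirstRowLength-framRows ms ss p′))
            (WellStacked-head F (proj₁ below)) (BlocksBalanced-snoc (rowWidths ms) _ A (proj₂ below) fits) [] []
  row≡ = sym (framRowLoop≡rowLoop m ms x A p)
  sorted-row : Sorted row
  sorted-row = subst Sorted row≡ (proj₁ facts)
  gap-row : ColumnGap row A
  gap-row = subst (λ r → ColumnGap r A) row≡ (proj₂ (proj₂ (proj₂ facts)))
  balanced-row : BlocksBalanced (rowWidths (m ∷ ms)) row
  balanced-row = subst (BlocksBalanced _) row≡ (proj₁ (proj₂ (proj₂ facts)))

NonIncreasing-cons : ∀ r T → NonIncreasing (map length T) → length (firstRow T) ℕ.≤ length r →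
  NonIncreasing (map length (r ∷ T))
NonIncreasing-cons r []       _ _ = tt
NonIncreasing-cons r (r′ ∷ T) p l = l , p

length-≤-or-empty : ∀ {A : Row} {n} → (length A ≡ n ⊎ A ≡ []) → length A ℕ.≤ n
length-≤-or-empty (inj₁ e)    = ℕP.≤-reflexive e
length-≤-or-empty (inj₂ refl) = z≤n

shape-framRows : ∀ μ s → NonIncreasing μ → NonIncreasing (map length (framRows μ s))
shape-framRows []       s        p = tt
shape-framRows (m ∷ ms) []       p = tt
shape-framRows (m ∷ ms) (x ∷ ss) p rewrite framRows-step m ms x ss =
  NonIncreasing-cons row (framRows ms ss) (shape-framRows ms ss p′) (begin
    length (firstRow (framRows ms ss)) ≤⟨ length-≤-or-empty (firstRow-framRows ms ss len) ⟩
    firstPart ms                       ≤⟨ firstPart-≤ m ms p ⟩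
    m                                  ≡⟨ sym (length-framRow m ms x ss p len) ⟩
    length row                         ∎)
  where
  open ℕP.≤-Reasoning
  p′ = NonIncreasing-tail m ms p
  len = FirstRowLength-framRows ms ss p′
  row = framRowLoop x m (reverse (blocksUp (m ∷ ms))) (firstRow (framRows ms ss))

framing⇒NonIncreasing : ∀ i μ s → FramingFrom i μ s → NonIncreasing μ
framing⇒NonIncreasing i []             []             _ = tt
framing⇒NonIncreasing i (m ∷ [])       (c ∷ cs)       _ = tt
framing⇒NonIncreasing i (m ∷ m′ ∷ ms) (c ∷ c′ ∷ cs) (_ , _ , (m′≤m , _) , rest) =
  m′≤m , framing⇒NonIncreasing (suc i) (m′ ∷ ms) (c′ ∷ cs) rest
framing⇒NonIncreasing i (m ∷ m′ ∷ ms) (c ∷ [])       (_ , _ , _ , ())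

-- The only consequence of framing used below: the tableau is well stacked and has partition shape.
framed-wellStacked : ∀ T → Framed T → WellStacked T × NonIncreasing (map length T)
framed-wellStacked T (framed μ s cond refl) =
  proj₁ (framRows-wellStacked μ s p) , shape-framRows μ s p
  where
  p = framing⇒NonIncreasing 1 μ s cond

NonIncreasing-firstRow : ∀ r T → NonIncreasing (map length (r ∷ T)) → length (firstRow T) ℕ.≤ length r
NonIncreasing-firstRow r []      _ = z≤n
NonIncreasing-firstRow r (_ ∷ _) p = proj₁ p

WellStacked-tail : ∀ r T → WellStacked (r ∷ T) → WellStacked T
WellStacked-tail r []       _ = tt
WellStacked-tail r (_ ∷ T) s = proj₂ (proj₂ s)

length-replaceFirst : ∀ x row → length (proj₁ (replaceFirst x row)) ≡ length row
length-replaceFirst x []       = refl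
length-replaceFirst x (a ∷ as) with (x + + 2) ≤ᵇ a
... | true  = refl
... | false = cong suc (length-replaceFirst x as)

replaceFirst-bumped∈ : ∀ x a as → ((x + + 2) ≤ᵇ lastOr x (a ∷ as)) ≡ true → proj₂ (replaceFirst x (a ∷ as)) ∈ (a ∷ as)
replaceFirst-bumped∈ x a as e with (x + + 2) ≤ᵇ a in e₂
... | true = here refl
replaceFirst-bumped∈ x a []         e | false with trans (sym e) e₂
... | ()
replaceFirst-bumped∈ x a (a′ ∷ as) e | false = there (replaceFirst-bumped∈ x a′ as e)

length-snoc-sortRow : ∀ (row : Row) x → length (sortRow (row ++ [ x ])) ≡ suc (length row)
length-snoc-sortRow row x = trans (length-sortRow (row ++ [ x ])) (trans (LP.length-++ row) (ℕP.+-comm (length row) 1))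

≤ᵇ-true : ∀ {u v} → u ≤ v → (u ≤ᵇ v) ≡ true
≤ᵇ-true {u} {v} h with u ≤ᵇ v | ℤP.≤⇒≤ᵇ h
... | true | _ = refl

bump-shape : ∀ x T ℓ → 1 ℕ.≤ ℓ → NonIncreasing (map length T) → WellStacked T → length (firstRow T) ℕ.≤ ℓ →
  (length (firstRow T) ≡ ℓ → x + + 2 ≤ lastOr x (firstRow T)) →
  NonIncreasing (map length (bump x T)) × length (firstRow (bump x T)) ℕ.≤ ℓ
bump-shape x []                  ℓ 1≤ℓ p s h full = tt , 1≤ℓ
bump-shape x ([] ∷ [])           ℓ 1≤ℓ p s h full = tt , 1≤ℓ
bump-shape x ([] ∷ r′ ∷ rows)   ℓ 1≤ℓ (r′≤0 , p) s h full = (ℕP.≤-trans r′≤0 z≤n , p) , 1≤ℓ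
bump-shape x ((r ∷ rs) ∷ rows)   ℓ 1≤ℓ p s h full with (x + + 2) ≤ᵇ lastOr x (r ∷ rs) in test
... | false =
  NonIncreasing-cons row′ rows (NonIncreasing-tail _ _ p)
    (ℕP.≤-trans (NonIncreasing-firstRow (r ∷ rs) rows p) (ℕP.≤-trans (ℕP.n≤1+n _) (ℕP.≤-reflexive (sym length-row′)))) ,
  subst (ℕ._≤ ℓ) (sym length-row′) (ℕP.≤∧≢⇒< h not-full)
  where
  row′ = sortRow ((r ∷ rs) ++ [ x ])
  length-row′ = length-snoc-sortRow (r ∷ rs) x
  -- a full row would have passed x on
  not-full : length (r ∷ rs) ≢ ℓ
  not-full e with trans (sym test) (≤ᵇ-true (full e))
  ... | ()
... | true =
  NonIncreasing-cons row′ (bump y rows) (proj₁ above) (ℕP.≤-trans (proj₂ above) (ℕP.≤-reflexive (sym length-row′))) ,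
  subst (ℕ._≤ ℓ) (sym length-row′) h
  where
  row = r ∷ rs
  row′ = sortRow (proj₁ (replaceFirst x row))
  y = proj₂ (replaceFirst x row)
  length-row′ = trans (length-sortRow (proj₁ (replaceFirst x row))) (length-replaceFirst x row)
  -- the row above passes y on when it is full, because it dominates row
  passes : ∀ rows → WellStacked (row ∷ rows) → length (firstRow rows) ≡ length row → y + + 2 ≤ lastOr y (firstRow rows)
  passes []          s ()
  passes (r′ ∷ rows) s e = All.lookup (proj₁ (proj₂ s) e) (replaceFirst-bumped∈ x r rs test)
  above = bump-shape y rows (length row) (s≤s z≤n) (NonIncreasing-tail _ _ p) (WellStacked-tail row rows s)
            (NonIncreasing-firstRow row rows p) (passes rows s)

stack-row : ∀ r T n → length r ≡ n → NonIncreasing (map length T) → length (firstRow T) ℕ.≤ n →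
  NonIncreasing (map length (r ∷ T)) × length r ℕ.≤ n
stack-row r T n e p h = NonIncreasing-cons r T p (subst (_ ℕ.≤_) (sym e) h) , ℕP.≤-reflexive e

holeLength : Row → Row → ℕ
holeLength pre suf = suc (length pre ℕ.+ length suf)

holeLength-step : ∀ (pre : Row) b suf → holeLength (pre ++ [ b ]) suf ≡ holeLength pre (b ∷ suf)
holeLength-step pre b suf = cong suc (trans (cong (ℕ._+ length suf) (LP.length-++ pre)) (ℕP.+-assoc (length pre) 1 (length suf)))

at-nothing : ∀ n (a : Row) → at n a ≡ nothing → length a ℕ.≤ n
at-nothing n       []      e  = z≤n
at-nothing zero    (_ ∷ a) ()
at-nothing (suc n) (_ ∷ a) e  = s≤s (at-nothing n a e)

at-just : ∀ n (a : Row) v → at n a ≡ just v → holeLength (take n a) (drop (suc n) a) ≡ length a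
at-just n       []      v ()
at-just zero    (_ ∷ a) v e = refl
at-just (suc n) (_ ∷ a) v e = cong suc (at-just n a v e)

delRow-shape : ∀ pre rest n → length pre ℕ.≤ n → NonIncreasing (map length rest) → length (firstRow rest) ℕ.≤ length pre →
  NonIncreasing (map length (delRow pre rest)) × length (firstRow (delRow pre rest)) ℕ.≤ n
delRow-shape []        rest n l p h = p , ℕP.≤-trans h l
delRow-shape (q ∷ pre) rest n l p h = NonIncreasing-cons (q ∷ pre) rest p h , l

SlideShape : Tableau → Row → Row → Set
SlideShape above pre suf =
  NonIncreasing (map length (slide above pre suf)) × length (firstRow (slide above pre suf)) ℕ.≤ holeLength pre suf

slideRight-shape : ∀ S pre b suf → NonIncreasing (map length S) × length (firstRow S) ℕ.≤ holeLength (pre ++ [ b ]) suf →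
  NonIncreasing (map length S) × length (firstRow S) ℕ.≤ holeLength pre (b ∷ suf)
slideRight-shape S pre b suf (p , h) = p , subst (length (firstRow S) ℕ.≤_) (holeLength-step pre b suf) h

slideUp-shape : ∀ (row a : Row) above (pre : Row) v n → length row ≡ n → length a ℕ.≤ n → at (length pre) a ≡ just v →
  SlideShape above (take (length pre) a) (drop (suc (length pre)) a) →
  NonIncreasing (map length (row ∷ slide above (take (length pre) a) (drop (suc (length pre)) a))) × length row ℕ.≤ n
slideUp-shape row a above pre v n e la found (p , h) =
  stack-row row S n e p (ℕP.≤-trans (subst (length (firstRow S) ℕ.≤_) (at-just (length pre) a v found) h) la)
  where
  S = slide above (take (length pre) a) (drop (suc (length pre)) a)

HoleMovesUp : Row → Tableau → Row → Set
HoleMovesUp a above pre =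
  NonIncreasing (holeLength (take (length pre) a) (drop (suc (length pre)) a) ∷ map length above) →
  SlideShape above (take (length pre) a) (drop (suc (length pre)) a)

HoleMovesRight : Row → Tableau → Row → ℤ → Row → Set
HoleMovesRight a above pre b suf =
  NonIncreasing (holeLength (pre ++ [ b ]) suf ∷ map length (a ∷ above)) → SlideShape (a ∷ above) (pre ++ [ b ]) suf

hole-up : ∀ (a : Row) (above : Tableau) (pre : Row) v → at (length pre) a ≡ just v → NonIncreasing (length a ∷ map length above) →
  NonIncreasing (holeLength (take (length pre) a) (drop (suc (length pre)) a) ∷ map length above)
hole-up a above pre v found p = subst (λ n → NonIncreasing (n ∷ map length above)) (sym (at-just (length pre) a v found)) p

hole-right : ∀ (a : Row) (above : Tableau) (pre : Row) b suf → NonIncreasing (holeLength pre (b ∷ suf) ∷ map length (a ∷ above)) →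
  NonIncreasing (holeLength (pre ++ [ b ]) suf ∷ map length (a ∷ above))
hole-right a above pre b suf (la , p) = subst (length a ℕ.≤_) (sym (holeLength-step pre b suf)) la , p

slideEnd-shape : ∀ (a : Row) (above : Tableau) (pre : Row) → NonIncreasing (holeLength pre [] ∷ map length (a ∷ above)) →
  HoleMovesUp a above pre → SlideShape (a ∷ above) pre []
slideEnd-shape a above pre (la , p) up with at (length pre) a in found
... | nothing = delRow-shape pre (a ∷ above) (holeLength pre []) (ℕP.m≤n⇒m≤1+n (ℕP.≤-reflexive (sym (ℕP.+-identityʳ _)))) p
                  (at-nothing (length pre) a found)
... | just v  = slideUp-shape (sortRow (pre ++ [ v ])) a above pre v (holeLength pre [])
                  (trans (length-snoc-sortRow pre v) (cong suc (sym (ℕP.+-identityʳ _)))) la found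
                  (up (hole-up a above pre v found p))

slideMid-shape : ∀ (a : Row) (above : Tableau) (pre : Row) b suf → NonIncreasing (holeLength pre (b ∷ suf) ∷ map length (a ∷ above)) →
  HoleMovesRight a above pre b suf → HoleMovesUp a above pre → SlideShape (a ∷ above) pre (b ∷ suf)
slideMid-shape a above pre b suf q@(la , p) right up with at (length pre) a in found
... | nothing = slideRight-shape (slide (a ∷ above) (pre ++ [ b ]) suf) pre b suf (right (hole-right a above pre b suf q))
... | just v with (b + + 2) ≤ᵇ v
...   | true  = slideRight-shape (slide (a ∷ above) (pre ++ [ b ]) suf) pre b suf (right (hole-right a above pre b suf q))
...   | false = slideUp-shape (sortRow (pre ++ [ v ] ++ b ∷ suf)) a above pre v (holeLength pre (b ∷ suf))
                  (trans (length-sortRow (pre ++ [ v ] ++ b ∷ suf)) (trans (LP.length-++ pre) (ℕP.+-suc (length pre) (suc (length suf)))))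
                  la found (up (hole-up a above pre v found p))

slide-shape : ∀ above pre suf → NonIncreasing (holeLength pre suf ∷ map length above) → SlideShape above pre suf
slide-shape []          pre []        _ =
  delRow-shape pre [] (holeLength pre []) (ℕP.m≤n⇒m≤1+n (ℕP.≤-reflexive (sym (ℕP.+-identityʳ _)))) tt z≤n
slide-shape []          pre (b ∷ suf) _ =
  slideRight-shape (slide [] (pre ++ [ b ]) suf) pre b suf (slide-shape [] (pre ++ [ b ]) suf tt)
slide-shape (a ∷ above) pre []        p =
  slideEnd-shape a above pre p (slide-shape above (take (length pre) a) (drop (suc (length pre)) a))
slide-shape (a ∷ above) pre (b ∷ suf) p =
  slideMid-shape a above pre b suf p (slide-shape (a ∷ above) (pre ++ [ b ]) suf)
    (slide-shape above (take (length pre) a) (drop (suc (length pre)) a))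

replaceFirst-shift : ∀ c x row →
  replaceFirst (x + c) (shiftRow c row) ≡ (shiftRow c (proj₁ (replaceFirst x row)) , proj₂ (replaceFirst x row) + c)
replaceFirst-shift c x []       = refl
replaceFirst-shift c x (a ∷ as) rewrite offset-≤ᵇ-shift c (+ 2) x a with (x + + 2) ≤ᵇ a
... | true  = refl
... | false rewrite replaceFirst-shift c x as = refl

bump-shift : ∀ c x T → bump (x + c) (shift c T) ≡ shift c (bump x T)
bump-shift c x []                = refl
bump-shift c x ([] ∷ rows)       = refl
bump-shift c x ((r ∷ rs) ∷ rows)
  rewrite lastOr-shift c x (r ∷ rs) | offset-≤ᵇ-shift c (+ 2) x (lastOr x (r ∷ rs))
  with (x + + 2) ≤ᵇ lastOr x (r ∷ rs)
... | false = cong (_∷ shift c rows)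
                (trans (cong sortRow (sym (LP.map-++ _ (r ∷ rs) [ x ]))) (sortRow-shift c ((r ∷ rs) ++ [ x ])))
... | true rewrite replaceFirst-shift c x (r ∷ rs) =
  cong₂ _∷_ (sortRow-shift c (proj₁ (replaceFirst x (r ∷ rs)))) (bump-shift c (proj₂ (replaceFirst x (r ∷ rs))) rows)

at-shift : ∀ c n a → at n (shiftRow c a) ≡ mapMaybe (_+ c) (at n a)
at-shift c n       []      = refl
at-shift c zero    (x ∷ a) = refl
at-shift c (suc n) (x ∷ a) = at-shift c n a

delRow-shift : ∀ c pre rest → delRow (shiftRow c pre) (shift c rest) ≡ shift c (delRow pre rest)
delRow-shift c []        rest = refl
delRow-shift c (p ∷ pre) rest = refl

snoc-shift : ∀ c (pre : Row) b → shiftRow c pre ++ [ b + c ] ≡ shiftRow c (pre ++ [ b ])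
snoc-shift c pre b = sym (LP.map-++ _ pre [ b ])

SlidesUp : ℤ → Row → Tableau → Row → Set
SlidesUp c a above pre =
  slide (shift c above) (take (length pre) (shiftRow c a)) (drop (suc (length pre)) (shiftRow c a))
  ≡ shift c (slide above (take (length pre) a) (drop (suc (length pre)) a))

slideEnd-shift : ∀ c a above pre → SlidesUp c a above pre →
  slide (shift c (a ∷ above)) (shiftRow c pre) [] ≡ shift c (slide (a ∷ above) pre [])
slideEnd-shift c a above pre up rewrite LP.length-map (λ t → t + c) pre | at-shift c (length pre) a with at (length pre) a
... | nothing = delRow-shift c pre (a ∷ above)
... | just v  = cong₂ _∷_ (trans (cong sortRow (snoc-shift c pre v)) (sortRow-shift c (pre ++ [ v ]))) up

slideMid-shift : ∀ c a above pre b suf →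
  slide (shift c (a ∷ above)) (shiftRow c (pre ++ [ b ])) (shiftRow c suf) ≡ shift c (slide (a ∷ above) (pre ++ [ b ]) suf) →
  SlidesUp c a above pre →
  slide (shift c (a ∷ above)) (shiftRow c pre) (shiftRow c (b ∷ suf)) ≡ shift c (slide (a ∷ above) pre (b ∷ suf))
slideMid-shift c a above pre b suf right up
  rewrite LP.length-map (λ t → t + c) pre | at-shift c (length pre) a with at (length pre) a
... | nothing = trans (cong (λ z → slide (shift c (a ∷ above)) z (shiftRow c suf)) (snoc-shift c pre b)) right
... | just v rewrite offset-≤ᵇ-shift c (+ 2) b v with (b + + 2) ≤ᵇ v
...   | true  = trans (cong (λ z → slide (shift c (a ∷ above)) z (shiftRow c suf)) (snoc-shift c pre b)) right
...   | false = cong₂ _∷_ (trans (cong sortRow (sym (LP.map-++ _ pre (v ∷ b ∷ suf)))) (sortRow-shift c (pre ++ [ v ] ++ b ∷ suf))) up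

slide-shift : ∀ c above pre suf → slide (shift c above) (shiftRow c pre) (shiftRow c suf) ≡ shift c (slide above pre suf)
slideUp-shift : ∀ c a above pre → SlidesUp c a above pre

slide-shift c []          pre []        = delRow-shift c pre []
slide-shift c []          pre (b ∷ suf) =
  trans (cong (λ z → slide [] z (shiftRow c suf)) (snoc-shift c pre b)) (slide-shift c [] (pre ++ [ b ]) suf)
slide-shift c (a ∷ above) pre []        = slideEnd-shift c a above pre (slideUp-shift c a above pre)
slide-shift c (a ∷ above) pre (b ∷ suf) =
  slideMid-shift c a above pre b suf (slide-shift c (a ∷ above) (pre ++ [ b ]) suf) (slideUp-shift c a above pre)

slideUp-shift c a above pre =
  trans (cong₂ (slide (shift c above)) (LP.take-map (length pre) a) (LP.drop-map (suc (length pre)) a))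
        (slide-shift c above (take (length pre) a) (drop (suc (length pre)) a))

-- The entry written by modifyRow, as a function of its three tests.
choose : Bool → Bool → Bool → ℤ → ℤ → ℤ → ℤ
choose B₁ B₂ B₃ u v w = if B₁ then u else (if B₂ ∧ B₃ then v else w)

choose-shift : ∀ B₁ B₂ B₃ u v w c → choose B₁ B₂ B₃ (u + c) (v + c) (w + c) ≡ choose B₁ B₂ B₃ u v w + c
choose-shift true  _     _     u v w c = refl
choose-shift false true  true  u v w c = refl
choose-shift false true  false u v w c = refl
choose-shift false false _     u v w c = refl

modifyRow-shift : ∀ c x lk as bs →
  modifyRow (x + c) (lk + c) (shiftRow c as) (shiftRow c bs) ≡ shiftRow c (modifyRow x lk as bs)
modifyRow-shift c x lk []       bs       = refl
modifyRow-shift c x lk (a ∷ as) []       = refl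
modifyRow-shift c x lk (a ∷ as) (b ∷ bs) = cong₂ _∷_ entry (modifyRow-shift c x lk as bs)
  where
  open ≡-Reasoning
  swap : ∀ x k c → x + c + k ≡ x + k + c
  swap = solve-∀
  entry : choose ((a + c) == (x + c)) ((x + c + + 2) <ᵇ (lk + c)) ((a + c) == (x + c + + 1)) (x + c + + 2) (x + c + + 3) (b + c)
          ≡ choose (a == x) ((x + + 2) <ᵇ lk) (a == (x + + 1)) (x + + 2) (x + + 3) b + c
  entry = begin
    choose ((a + c) == (x + c)) ((x + c + + 2) <ᵇ (lk + c)) ((a + c) == (x + c + + 1)) (x + c + + 2) (x + c + + 3) (b + c)
      ≡⟨ cong₂ (λ B₂ B₃ → choose ((a + c) == (x + c)) B₂ B₃ (x + c + + 2) (x + c + + 3) (b + c))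
               (cong (_<ᵇ (lk + c)) (swap x (+ 2) c)) (cong ((a + c) ==_) (swap x (+ 1) c)) ⟩
    choose ((a + c) == (x + c)) ((x + + 2 + c) <ᵇ (lk + c)) ((a + c) == (x + + 1 + c)) (x + c + + 2) (x + c + + 3) (b + c)
      ≡⟨ cong₂ (λ B₁ B₃ → choose B₁ ((x + + 2 + c) <ᵇ (lk + c)) B₃ (x + c + + 2) (x + c + + 3) (b + c))
               (==-shift c a x) (==-shift c a (x + + 1)) ⟩
    choose (a == x) ((x + + 2 + c) <ᵇ (lk + c)) (a == (x + + 1)) (x + c + + 2) (x + c + + 3) (b + c)
      ≡⟨ cong (λ B₂ → choose (a == x) B₂ (a == (x + + 1)) (x + c + + 2) (x + c + + 3) (b + c)) (<ᵇ-shift c (x + + 2) lk) ⟩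
    choose (a == x) ((x + + 2) <ᵇ lk) (a == (x + + 1)) (x + c + + 2) (x + c + + 3) (b + c)
      ≡⟨ cong₂ (λ u v → choose (a == x) ((x + + 2) <ᵇ lk) (a == (x + + 1)) u v (b + c)) (swap x (+ 2) c) (swap x (+ 3) c) ⟩
    choose (a == x) ((x + + 2) <ᵇ lk) (a == (x + + 1)) (x + + 2 + c) (x + + 3 + c) (b + c)
      ≡⟨ choose-shift (a == x) ((x + + 2) <ᵇ lk) (a == (x + + 1)) (x + + 2) (x + + 3) b c ⟩
    choose (a == x) ((x + + 2) <ᵇ lk) (a == (x + + 1)) (x + + 2) (x + + 3) b + c ∎

length-modifyRow : ∀ x lk as bs → length (modifyRow x lk as bs) ≡ length bs
length-modifyRow x lk []       bs       = refl
length-modifyRow x lk (a ∷ as) []       = refl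
length-modifyRow x lk (a ∷ as) (b ∷ bs) = cong suc (length-modifyRow x lk as bs)

TranslationInvariant : (ℤ → Row → Bool) → Set
TranslationInvariant cond = ∀ c x row → cond (x + c) (shiftRow c row) ≡ cond x row

-- The corrections d_k are differences of row sums, hence unchanged by translation.
step2Loop-shift : ∀ cond → TranslationInvariant cond → ∀ c x rowk rs →
  step2Loop cond (x + c) (shiftRow c rowk) (shift c rs) ≡ step2Loop cond x rowk rs
step2Loop-shift cond inv c x rowk []       = refl
step2Loop-shift cond inv c x rowk (r ∷ rs) rewrite inv c x rowk with cond x rowk
... | false = cong (+ 0 ∷_) (trans (sym (LP.map-∘ rs)) (LP.map-cong (λ _ → refl) rs))
... | true  = cong₂ _∷_ correction rest
  where
  r′ = modifyRow x (lastOr x rowk) rowk r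
  modified : modifyRow (x + c) (lastOr (x + c) (shiftRow c rowk)) (shiftRow c rowk) (shiftRow c r) ≡ shiftRow c r′
  modified = trans (cong (λ z → modifyRow (x + c) z (shiftRow c rowk) (shiftRow c r)) (lastOr-shift c x rowk))
                   (modifyRow-shift c x (lastOr x rowk) rowk r)
  cancel : ∀ s n s′ → s + n - (s′ + n) ≡ s - s′
  cancel = solve-∀
  correction : sum (shiftRow c r) - sum (modifyRow (x + c) (lastOr (x + c) (shiftRow c rowk)) (shiftRow c rowk) (shiftRow c r))
               ≡ sum r - sum r′
  correction = begin
    _                                                        ≡⟨ cong (λ z → sum (shiftRow c r) - sum z) modified ⟩
    sum (shiftRow c r) - sum (shiftRow c r′)                 ≡⟨ cong₂ _-_ (sum-shiftRow c r) (sum-shiftRow c r′) ⟩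
    sum r + + length r * c - (sum r′ + + length r′ * c)      ≡⟨ cong (λ z → sum r + + length r * c - (sum r′ + + z * c))
                                                                     (length-modifyRow x (lastOr x rowk) rowk r) ⟩
    sum r + + length r * c - (sum r′ + + length r * c)       ≡⟨ cancel (sum r) (+ length r * c) (sum r′) ⟩
    sum r - sum r′                                           ∎
    where open ≡-Reasoning
  swap : ∀ x c → x + c + + 2 ≡ x + + 2 + c
  swap = solve-∀
  rest : step2Loop cond (x + c + + 2) (modifyRow (x + c) (lastOr (x + c) (shiftRow c rowk)) (shiftRow c rowk) (shiftRow c r)) (shift c rs)
         ≡ step2Loop cond (x + + 2) r′ rs
  rest = trans (cong₂ (λ u v → step2Loop cond u v (shift c rs)) (swap x c) modified) (step2Loop-shift cond inv c (x + + 2) r′ rs)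

newSums-shift : ∀ c Y ds → newSums (map sum (shift c Y)) ds ≡ shiftSums c (map length Y) (newSums (map sum Y) ds)
newSums-shift c Y ds = go Y (zipWith _,_ (+ 0 ∷ ds) (ds ++ [ + 0 ]))
  where
  correct : ℤ → ℤ × ℤ → ℤ
  correct sk p = sk - proj₁ p + proj₂ p
  regroup : ∀ s n a b → s + n - a + b ≡ s - a + b + n
  regroup = solve-∀
  go : ∀ Y PQ → zipWith correct (map sum (shift c Y)) PQ ≡ shiftSums c (map length Y) (zipWith correct (map sum Y) PQ)
  go []      PQ       = refl
  go (r ∷ Y) []       = refl
  go (r ∷ Y) (p ∷ PQ) = cong₂ _∷_
    (trans (cong (λ z → z - proj₁ p + proj₂ p) (sum-shiftRow c r)) (regroup (sum r) _ (proj₁ p) (proj₂ p)))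
    (go Y PQ)

map-length-shift : ∀ c (Y : Tableau) → map length (shift c Y) ≡ map length Y
map-length-shift c []      = refl
map-length-shift c (r ∷ Y) = cong₂ _∷_ (LP.length-map _ r) (map-length-shift c Y)

step2and3-shift : ∀ cond → TranslationInvariant cond → ∀ c x Y → NonIncreasing (map length Y) →
  step2and3 cond (x + c) (shift c Y) ≡ shift c (step2and3 cond x Y)
step2and3-shift cond inv c x []        p = refl
step2and3-shift cond inv c x (y₁ ∷ ys) p = begin
  Fram (map length (shift c (y₁ ∷ ys))) (newSums (map sum (shift c (y₁ ∷ ys))) (step2Loop cond (x + c) (shiftRow c y₁) (shift c ys)))
    ≡⟨ cong₂ Fram (map-length-shift c (y₁ ∷ ys)) (cong (newSums (map sum (shift c (y₁ ∷ ys)))) (step2Loop-shift cond inv c x y₁ ys)) ⟩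
  Fram μ (newSums (map sum (shift c (y₁ ∷ ys))) ds)   ≡⟨ cong (Fram μ) (newSums-shift c (y₁ ∷ ys) ds) ⟩
  Fram μ (shiftSums c μ (newSums (map sum (y₁ ∷ ys)) ds)) ≡⟨ Fram-shift μ (newSums (map sum (y₁ ∷ ys)) ds) c p ⟩
  shift c (Fram μ (newSums (map sum (y₁ ∷ ys)) ds))   ∎
  where
  open ≡-Reasoning
  μ = map length (y₁ ∷ ys)
  ds = step2Loop cond x y₁ ys

insCond-invariant : TranslationInvariant insCond
insCond-invariant c x row =
  trans (cong (λ z → (x + c + + 2) ≤ᵇ z) (lastOr-shift c x row)) (offset-≤ᵇ-shift c (+ 2) x (lastOr x row))

remCond-invariant : TranslationInvariant remCond
remCond-invariant c x row = cong₂ _∧_ (insCond-invariant c x row)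
  (trans (cong₂ _≤ᵇ_ (headOr-shift c x row) (swap x c)) (≤ᵇ-shift c (headOr x row) (x + + 1)))
  where
  swap : ∀ x c → x + c + + 1 ≡ x + + 1 + c
  swap = solve-∀

insert-shift : ∀ T x c → NonIncreasing (map length (bump x T)) → insert (shift c T) (x + c) ≡ shift c (insert T x)
insert-shift T x c p =
  trans (cong (step2and3 insCond (x + c)) (bump-shift c x T)) (step2and3-shift insCond insCond-invariant c x (bump x T) p)

remove-shift : ∀ T c → NonIncreasing (map length (removeStep1 T)) → remove (shift c T) ≡ shift c (remove T)
remove-shift []               c p = refl
remove-shift ([] ∷ rows)      c p = refl
remove-shift ((x ∷ r) ∷ rows) c p =
  trans (cong (step2and3 remCond (x + c)) (slide-shift c rows [] r)) (step2and3-shift remCond remCond-invariant c x (slide rows [] r) p)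

bump-partition : ∀ y T → WellStacked T → NonIncreasing (map length T) → NonIncreasing (map length (bump y T))
bump-partition y T s p = proj₁ (bump-shape y T (suc (length (firstRow T))) (s≤s z≤n) p s (ℕP.n≤1+n _) (⊥-elim ∘ too-long))
  where
  too-long : length (firstRow T) ≢ suc (length (firstRow T))
  too-long e = ℕP.<-irrefl e (ℕP.n<1+n _)

removeStep1-partition : ∀ T → NonIncreasing (map length T) → NonIncreasing (map length (removeStep1 T))
removeStep1-partition []               p = tt
removeStep1-partition ([] ∷ rows)      p = NonIncreasing-tail _ _ p
removeStep1-partition ((y ∷ r) ∷ rows) p = proj₁ (slide-shape rows [] r p)

mainTheorem12 : (T : Tableau) → Framed T → (x : ℕ) → (+ x + + 1) ≤t11 T →
    (insert T (+ x + + 1) ≡ shift (+ x) (insert (shift (- (+ x)) T) (+ 1)))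
    × (t11 T ≡ just (+ x + + 1) →
       remove T ≡ shift (+ x) (remove (shift (- (+ x)) T)))
mainTheorem12 T framedT x _ = insertion , λ _ → removal
  where
  open ≡-Reasoning
  stacked = proj₁ (framed-wellStacked T framedT)
  partition = proj₂ (framed-wellStacked T framedT)
  cancel : ∀ y → y + + 1 + - y ≡ + 1
  cancel = solve-∀
  insertion : insert T (+ x + + 1) ≡ shift (+ x) (insert (shift (- (+ x)) T) (+ 1))
  insertion = begin
    insert T (+ x + + 1)                                             ≡⟨ sym (shift-cancel x _) ⟩
    shift (+ x) (shift (- (+ x)) (insert T (+ x + + 1)))             ≡⟨ cong (shift (+ x))
      (sym (insert-shift T (+ x + + 1) (- (+ x)) (bump-partition (+ x + + 1) T stacked partition))) ⟩
    shift (+ x) (insert (shift (- (+ x)) T) (+ x + + 1 + - (+ x)))   ≡⟨ cong (shift (+ x) ∘ insert (shift (- (+ x)) T)) (cancel (+ x)) ⟩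
    shift (+ x) (insert (shift (- (+ x)) T) (+ 1))                   ∎
  removal : remove T ≡ shift (+ x) (remove (shift (- (+ x)) T))
  removal = begin
    remove T                                        ≡⟨ sym (shift-cancel x _) ⟩
    shift (+ x) (shift (- (+ x)) (remove T))        ≡⟨ cong (shift (+ x))
      (sym (remove-shift T (- (+ x)) (removeStep1-partition T partition))) ⟩
    shift (+ x) (remove (shift (- (+ x)) T))        ∎
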